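{- Let $q$ be a power of a prime $p$, $n\ge1$, and let $f(X)=\sum_{i=0}^{q^n-1}a_iX^i\in\mathbb F_{q^n}[X]$. Then $f:\mathbb F_{q^n}\to\mathbb F_{q^n}$ is $1$st order sum-free if and only if \[ \sum_{i=0}^{q^n-1}a_ib^ig_{i,q}(d)\ne 0 \] for all $b\in\mathbb F_{q^n}^*$ and all $d\in\mathbb F_{q^n}$ with $\mathrm{Tr}_{q^n/q}(d)=0$.
   Context: The polynomials $g_{i,q}\in\mathbb F_p[X]$ ($i\ge0$) are defined recursively by $g_{0,q}=\cdots=g_{q-2,q}=0$, $g_{q-1,q}=-1$, and $g_{i,q}=Xg_{i-q,q}+g_{i-q+1,q}$ for $i\ge q$; they satisfy $\sum_{x\in\mathbb F_q}(x+X)^i=g_{i,q}(X^q-X)$. A function $f:\mathbb F_{q^n}\to\mathbb F_{q^n}$ is $1$st order sum-free if $\sum_{x\in A}f(x)\ne0$ for every $1$-dimensional $\mathbb F_q$-affine subspace $A$ of $\mathbb F_{q^n}$. The convention $b^0=1$ is used. -}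

module Defs where

open import Level using (Level; _⊔_) renaming (suc to lsuc)
open import Algebra.Bundles using (CommutativeRing)
open import Data.Nat using (ℕ; zero; suc; _∸_) renaming (_+_ to _+ℕ_)
open import Data.Nat.Properties using (<-cmp)
open import Data.List using (List; []; _∷_; length; map; filter)
open import Data.List.Relation.Unary.Any using (Any)
open import Data.List.Relation.Unary.Unique.Setoid using (Unique)
open import Data.Product using (∃)
open import Relation.Nullary using (¬_)
open import Relation.Binary using (Decidable; tri<; tri≈; tri>)

record FiniteField (c ℓ : Level) : Set (lsuc (c ⊔ ℓ)) where
  field
    commRing : CommutativeRing c ℓ
  open CommutativeRing commRing public
  field
    _≟_       : Decidable _≈_
    1≉0       : ¬ (1# ≈ 0#)
    inverse   : ∀ x → ¬ (x ≈ 0#) → ∃ λ y → x * y ≈ 1#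
    elements  : List Carrier
    complete  : ∀ x → Any (x ≈_) elements
    unique    : Unique setoid elements

module FF {c ℓ : Level} (F : FiniteField c ℓ) where
  open FiniteField F

  -- x ^ i, with the convention x ^ 0 = 1 (so 0 ^ 0 = 1)
  pow : Carrier → ℕ → Carrier
  pow x zero    = 1#
  pow x (suc i) = x * pow x i

  Σ< : ℕ → (ℕ → Carrier) → Carrier
  Σ< zero    h = 0#
  Σ< (suc n) h = Σ< n h + h n

  sumL : List Carrier → Carrier
  sumL []       = 0#
  sumL (x ∷ xs) = x + sumL xs

  Fq : ℕ → List Carrier
  Fq q = filter (λ x → pow x q ≟ x) elements

  Tr : ℕ → ℕ → Carrier → Carrier
  Tr q n d = Σ< n (λ j → pow d (q Data.Nat.^ j))

  -- g_{i,q} evaluated at X, computed with fuel (fuel suc i suffices for q ≥ 2,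
  -- since then both i ∸ q and i ∸ q + 1 are < i when i ≥ q).
  gF : ℕ → ℕ → ℕ → Carrier → Carrier
  gF zero     q i X = 0#
  gF (suc k)  q i X with <-cmp i (q ∸ 1)
  ... | tri< _ _ _ = 0#
  ... | tri≈ _ _ _ = - 1#
  ... | tri> _ _ _ = X * gF k q (i ∸ q) X + gF k q ((i ∸ q) +ℕ 1) X

  g : ℕ → ℕ → Carrier → Carrier
  g i q X = gF (suc i) q i X

  polyFun : ℕ → (ℕ → Carrier) → Carrier → Carrier
  polyFun N a x = Σ< N (λ i → a i * pow x i)

  -- 1st order sum-free: for every 1-dim F_q-affine subspace A = u + F_q v (v ≠ 0),
  -- Σ_{x ∈ A} f(x) ≠ 0
  SumFree1 : ℕ → (Carrier → Carrier) → Set (c ⊔ ℓ)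
  SumFree1 q f = ∀ u v → ¬ (v ≈ 0#) →
    ¬ (sumL (map (λ t → f (u + t * v)) (Fq q)) ≈ 0#)

module Submission where

-- Write a point of the line A = u + F_q v as v (t + w) with w = u / v.  Then
--   Σ_{x ∈ A} f(x) = Σ_i a_i v^i Σ_{t ∈ F_q} (t + w)^i,
-- and the inner sums obey the recursion defining g_{i,q} at X = w^q - w: for t ∈ F_q
-- Frobenius gives (t + w)^q = t + w^q, while the binomial theorem reduces the initial
-- values i ≤ q - 1 to the power sums Σ_{t ∈ F_q} t^m, which vanish for m < q - 1 and
-- equal -1 for m = q - 1.  So Σ_{x ∈ A} f(x) = Σ_i a_i v^i g_{i,q}(w^q - w), and by the
-- additive Hilbert 90 the values w^q - w are exactly the elements of trace zero.
-- Counting enters through the root bound for polynomials: it gives |F_q| ≥ q, an element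
-- of nonzero trace, and, for 0 < m < q - 1, some γ ∈ F_q^* with γ^m ≠ 1, whence
-- Σ_{t ∈ F_q} t^m = 0 because t ↦ γ t permutes F_q.

open import Level using (_⊔_)
open import Function.Base using (_∘_)
open import Function.Bundles using (_⇔_; mk⇔)
open import Data.Bool using (true; false)
open import Data.Product using (_,_; proj₁; proj₂; ∃; ∃₂)
open import Data.Sum using (inj₁; inj₂)
open import Data.Maybe using (Maybe; just; nothing)
open import Data.Sign as Sign using (Sign)
open import Data.Nat as ℕ using (ℕ; zero; suc; _∸_; _^_; _≥_)
import Data.Nat.Properties as ℕ
open import Data.Nat.Tactic.RingSolver using (solve-∀)
open import Data.Nat.Divisibility using (_∣_; divides; ∣⇒≤)
open import Data.Nat.Primality using (Prime; euclidsLemma; prime⇒nonTrivial; prime⇒nonZero)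
open import Data.Nat.Combinatorics using (_C_; nC1≡n; nCn≡1; nCk+nC[k+1]≡[n+1]C[k+1])
open import Data.Integer as ℤ using (ℤ; 0ℤ; 1ℤ; -[1+_]; _⊖_; _◃_; sign; ∣_∣)
import Data.Integer.Properties as ℤ
open import Data.Fin using (toℕ)
open import Data.List using (List; []; _∷_; _++_; length; map; filter; foldr)
import Data.List.Properties as List
open import Data.List.Relation.Unary.Any using (here; there)
open import Data.List.Relation.Unary.All as All using (All; []; _∷_)
open import Data.List.Relation.Unary.All.Properties using (all-filter; ¬All⇒Any¬)
open import Data.List.Relation.Unary.AllPairs using (_∷_)
open import Relation.Nullary using (Dec; yes; no; does; ¬_; ¬?; contradiction)
open import Relation.Unary using (Pred; Decidable)
open import Relation.Unary.Properties using (∁?)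
open import Relation.Binary.Definitions using (_Respects_; tri<; tri≈; tri>)
open import Relation.Binary.PropositionalEquality using (_≡_)
import Relation.Binary.PropositionalEquality as ≡
open import Algebra.Bundles using (CommutativeRing)
open import Algebra.Definitions using (Congruent₁)
open import Algebra.Solver.Ring.AlmostCommutativeRing
  using (fromCommutativeRing; _-Raw-AlmostCommutative⟶_)

open import Defs

-- The ring solver over R with integer coefficients, mapped into R by ι.  (With R itself
-- as coefficient ring, as in Algebra.Solver.Ring.Simple, normalisation cannot cancel x - x.)
module IntegerCoefficientSolver {c ℓ} (R : CommutativeRing c ℓ) where
  open CommutativeRing R
  open import Algebra.Properties.Ring ring
  open import Algebra.Properties.Monoid.Mult.TCOptimised +-monoid using (_×_; ×-homo-+)
  open import Algebra.Properties.Semiring.Mult.TCOptimised semiring using (×1-homo-*)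
  open import Algebra.Properties.CommutativeSemigroup +-commutativeSemigroup using (interchange)
  open import Relation.Binary.Reasoning.Setoid setoid

  ι : ℤ → Carrier
  ι (ℤ.+ n)  = n × 1#
  ι -[1+ n ] = - (suc n × 1#)

  signed : Sign → Carrier → Carrier
  signed Sign.+ x = x
  signed Sign.- x = - x

  signed-cong : ∀ s {x y} → x ≈ y → signed s x ≈ signed s y
  signed-cong Sign.+ x≈y = x≈y
  signed-cong Sign.- x≈y = -‿cong x≈y

  signed-* : ∀ s t x y → signed (s Sign.* t) (x * y) ≈ signed s x * signed t y
  signed-* Sign.+ Sign.+ x y = refl
  signed-* Sign.+ Sign.- x y = -‿distribʳ-* x y
  signed-* Sign.- Sign.+ x y = -‿distribˡ-* x y
  signed-* Sign.- Sign.- x y = begin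
    x * y         ≈⟨ -‿involutive _ ⟨
    - - (x * y)   ≈⟨ -‿cong (-‿distribˡ-* x y) ⟩
    - (- x * y)   ≈⟨ -‿distribʳ-* (- x) y ⟩
    - x * - y     ∎

  ι-◃ : ∀ s n → ι (s ◃ n) ≈ signed s (n × 1#)
  ι-◃ Sign.+ zero    = refl
  ι-◃ Sign.- zero    = sym -0#≈0#
  ι-◃ Sign.+ (suc n) = refl
  ι-◃ Sign.- (suc n) = refl

  ι-signAbs : ∀ i → ι i ≈ signed (sign i) (∣ i ∣ × 1#)
  ι-signAbs (ℤ.+ n)  = refl
  ι-signAbs -[1+ n ] = refl

  ι-* : ∀ i j → ι (i ℤ.* j) ≈ ι i * ι j
  ι-* i j = begin
    ι (i ℤ.* j)                                     ≈⟨ ι-◃ (s Sign.* t) (∣ i ∣ ℕ.* ∣ j ∣) ⟩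
    signed (s Sign.* t) ((∣ i ∣ ℕ.* ∣ j ∣) × 1#)    ≈⟨ signed-cong (s Sign.* t) (×1-homo-* ∣ i ∣ ∣ j ∣) ⟩
    signed (s Sign.* t) (∣ i ∣ × 1# * ∣ j ∣ × 1#)   ≈⟨ signed-* s t _ _ ⟩
    signed s (∣ i ∣ × 1#) * signed t (∣ j ∣ × 1#)   ≈⟨ *-cong (ι-signAbs i) (ι-signAbs j) ⟨
    ι i * ι j                                       ∎
    where
    s = sign i
    t = sign j

  ι-⊖ : ∀ m n → ι (m ⊖ n) ≈ m × 1# - n × 1#
  ι-⊖ m       zero    = sym (trans (+-congˡ -0#≈0#) (+-identityʳ _))
  ι-⊖ zero    (suc n) = sym (+-identityˡ _)
  ι-⊖ (suc m) (suc n) = begin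
    ι (suc m ⊖ suc n)                 ≡⟨ ≡.cong ι (ℤ.[1+m]⊖[1+n]≡m⊖n m n) ⟩
    ι (m ⊖ n)                         ≈⟨ ι-⊖ m n ⟩
    m × 1# - n × 1#                   ≈⟨ +-identityˡ _ ⟨
    0# + (m × 1# - n × 1#)            ≈⟨ +-congʳ (-‿inverseʳ 1#) ⟨
    (1# - 1#) + (m × 1# - n × 1#)     ≈⟨ interchange 1# (m × 1#) (- 1#) (- (n × 1#)) ⟨
    (1# + m × 1#) + (- 1# - n × 1#)   ≈⟨ +-cong (sym (×-homo-+ 1# 1 m))
                                                (trans (-‿+-comm 1# (n × 1#)) (-‿cong (sym (×-homo-+ 1# 1 n)))) ⟩
    suc m × 1# - suc n × 1#           ∎

  ι-+ : ∀ i j → ι (i ℤ.+ j) ≈ ι i + ι j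
  ι-+ (ℤ.+ m)  (ℤ.+ n)  = ×-homo-+ 1# m n
  ι-+ (ℤ.+ m)  -[1+ n ] = ι-⊖ m (suc n)
  ι-+ -[1+ m ] (ℤ.+ n)  = trans (ι-⊖ n (suc m)) (+-comm _ _)
  ι-+ -[1+ m ] -[1+ n ] = begin
    - (suc (suc (m ℕ.+ n)) × 1#)   ≡⟨ ≡.cong (λ k → - (suc k × 1#)) (ℕ.+-suc m n) ⟨
    - ((suc m ℕ.+ suc n) × 1#)     ≈⟨ -‿cong (×-homo-+ 1# (suc m) (suc n)) ⟩
    - (suc m × 1# + suc n × 1#)    ≈⟨ -‿+-comm _ _ ⟨
    - (suc m × 1#) - suc n × 1#    ∎

  ι-neg : ∀ i → ι (ℤ.- i) ≈ - ι i
  ι-neg (ℤ.+ zero)  = sym -0#≈0#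
  ι-neg (ℤ.+ suc n) = refl
  ι-neg -[1+ n ]    = sym (-‿involutive _)

  ℤ⟶R : ℤ.+-*-rawRing -Raw-AlmostCommutative⟶ fromCommutativeRing R
  ℤ⟶R = record
    { ⟦_⟧ = ι ; +-homo = ι-+ ; *-homo = ι-* ; -‿homo = ι-neg ; 0-homo = refl ; 1-homo = refl }

  ι-≟ : ∀ i j → Maybe (ι i ≈ ι j)
  ι-≟ i j with i ℤ.≟ j
  ... | yes ≡.refl = just refl
  ... | no  _      = nothing

  open import Algebra.Solver.Ring ℤ.+-*-rawRing (fromCommutativeRing R) ℤ⟶R ι-≟ public

module _ where
  open import Data.Nat using (_+_; _*_; _≤_; _<_; s≤s; z≤n)

  [1+k]*[1+n]C[1+k]≡[1+n]*nCk : ∀ n k → suc k * (suc n C suc k) ≡ suc n * (n C k)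
  [1+k]*[1+n]C[1+k]≡[1+n]*nCk zero    zero    = ≡.refl
  [1+k]*[1+n]C[1+k]≡[1+n]*nCk zero    (suc k) = ℕ.*-zeroʳ (suc (suc k))
  [1+k]*[1+n]C[1+k]≡[1+n]*nCk (suc n) zero    =
    ≡.trans (ℕ.+-identityʳ _) (≡.trans (nC1≡n (suc (suc n))) (≡.cong suc (≡.sym (ℕ.*-identityʳ (suc n)))))
  [1+k]*[1+n]C[1+k]≡[1+n]*nCk (suc n) (suc k) = begin
    suc (suc k) * (suc (suc n) C suc (suc k))      ≡⟨ ≡.cong (suc (suc k) *_) (pascal (suc n) (suc k)) ⟨
    suc (suc k) * (A + B)                          ≡⟨ distribute k A B ⟩
    A + (suc k * A + suc (suc k) * B)              ≡⟨ ≡.cong (A +_) (≡.cong₂ _+_ ([1+k]*[1+n]C[1+k]≡[1+n]*nCk n k)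
                                                                                ([1+k]*[1+n]C[1+k]≡[1+n]*nCk n (suc k))) ⟩
    A + (suc n * (n C k) + suc n * (n C suc k))    ≡⟨ ≡.cong (A +_) (ℕ.*-distribˡ-+ (suc n) (n C k) (n C suc k)) ⟨
    A + suc n * (n C k + n C suc k)                ≡⟨ ≡.cong (λ m → A + suc n * m) (pascal n k) ⟩
    suc (suc n) * A                                ∎
    where
    open ≡.≡-Reasoning
    pascal = nCk+nC[k+1]≡[n+1]C[k+1]
    A = suc n C suc k
    B = suc n C suc (suc k)
    distribute : ∀ k a b → (2 + k) * (a + b) ≡ a + ((1 + k) * a + (2 + k) * b)
    distribute = solve-∀

  p∣pCk : ∀ {p k} → Prime p → 0 < k → k < p → p ∣ p C k
  p∣pCk {suc m} {suc j} p-prime _ (s≤s j<m)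
    with euclidsLemma (suc j) (suc m C suc j) p-prime
           (divides (m C j) (≡.trans ([1+k]*[1+n]C[1+k]≡[1+n]*nCk m j) (ℕ.*-comm (suc m) (m C j))))
  ... | inj₁ p∣k    = contradiction (∣⇒≤ p∣k) (ℕ.<⇒≱ (s≤s j<m))
  ... | inj₂ p∣pCk = p∣pCk

  prime^k≥2 : ∀ {p k} → Prime p → 1 ≤ k → 2 ≤ p ^ k
  prime^k≥2 {p} {k} p-prime k≥1 = ℕ.≤-trans (ℕ.nonTrivial⇒n>1 p ⦃ prime⇒nonTrivial p-prime ⦄)
    (ℕ.≤-trans (ℕ.≤-reflexive (≡.sym (ℕ.*-identityʳ p))) (ℕ.^-monoʳ-≤ p ⦃ prime⇒nonZero p-prime ⦄ k≥1))

  [2+a]^[1+m]≡2+a+[1+a]r : ∀ a m → ∃ λ r → (2 + a) ^ suc m ≡ 2 + a + suc a * r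
  [2+a]^[1+m]≡2+a+[1+a]r a zero    = 0 , base a
    where
    base : ∀ a → (2 + a) * 1 ≡ 2 + a + suc a * 0
    base = solve-∀
  [2+a]^[1+m]≡2+a+[1+a]r a (suc m) with r , eq ← [2+a]^[1+m]≡2+a+[1+a]r a m =
    2 + a + (2 + a) * r , ≡.trans (≡.cong ((2 + a) *_) eq) (step a r)
    where
    step : ∀ a r → (2 + a) * (2 + a + suc a * r) ≡ 2 + a + suc a * (2 + a + (2 + a) * r)
    step = solve-∀

  m+n≡1+o+p⇒p<n : ∀ {m n o p} → m + n ≡ suc (o + p) → m ≤ o → p < n
  m+n≡1+o+p⇒p<n {m} {n} {o} {p} m+n≡1+o+p m≤o = ℕ.+-cancelˡ-≤ o _ _
    (ℕ.≤-trans (ℕ.≤-reflexive (≡.trans (ℕ.+-suc o p) (≡.sym m+n≡1+o+p))) (ℕ.+-monoˡ-≤ n m≤o))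

  length-filter-∁ : ∀ {a p} {A : Set a} {P : Pred A p} (P? : Decidable P) xs →
                    length (filter P? xs) + length (filter (∁? P?) xs) ≡ length xs
  length-filter-∁ P? []       = ≡.refl
  length-filter-∁ P? (x ∷ xs) with does (P? x)
  ... | true  = ≡.cong suc (length-filter-∁ P? xs)
  ... | false = ≡.trans (ℕ.+-suc _ _) (≡.cong suc (length-filter-∁ P? xs))

module FiniteFieldTheory {c ℓ} (F : FiniteField c ℓ) where
  open FiniteField F
  open FF F
  open import Algebra.Properties.Ring ring
  open import Algebra.Properties.CommutativeSemigroup +-commutativeSemigroup using (interchange)
  open import Algebra.Properties.Monoid.Mult +-monoid using (_×_; ×-congʳ)
  open import Algebra.Properties.Semiring.Mult semiring using (×-assoc-*; ×1-homo-*)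
  open import Algebra.Properties.Monoid.Sum +-monoid using (sum)
  import Algebra.Properties.Semiring.Exp semiring as Exp
  import Algebra.Properties.CommutativeSemiring.Exp commutativeSemiring as CExp
  import Algebra.Properties.CommutativeSemiring.Binomial commutativeSemiring as Binomial
  open IntegerCoefficientSolver commRing using (solve; _:=_; _:+_; _:*_; _:-_; :-_; con)
  open import Relation.Binary.Reasoning.Setoid setoid
  open import Data.List.Membership.Setoid setoid using (_∈_; find)
  open import Data.List.Membership.Setoid.Properties
    using (∈-resp-≈; ∈-∃++; ∈-map⁺; ∈-map⁻; ∈-filter⁺; ∈-filter⁻)
  open import Data.List.Relation.Binary.Subset.Setoid setoid using (_⊆_)
  open import Data.List.Relation.Binary.Permutation.Setoid setoid
    using (_↭_; ↭-refl; ↭-sym; ↭-trans; ↭-reflexive-≋; prep)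
  import Data.List.Relation.Binary.Permutation.Setoid.Properties setoid as ↭
  open import Data.List.Relation.Unary.Unique.Setoid setoid using (Unique)
  import Data.List.Relation.Unary.Unique.Setoid.Properties as Unique!
  open Unique! using (Unique[x∷xs]⇒x∉xs)

  Σ<-cong : ∀ n {f g : ℕ → Carrier} → (∀ {i} → i ℕ.< n → f i ≈ g i) → Σ< n f ≈ Σ< n g
  Σ<-cong zero    f≈g = refl
  Σ<-cong (suc n) f≈g = +-cong (Σ<-cong n (f≈g ∘ ℕ.m<n⇒m<1+n)) (f≈g (ℕ.n<1+n n))

  Σ<-zero : ∀ n {f : ℕ → Carrier} → (∀ {i} → i ℕ.< n → f i ≈ 0#) → Σ< n f ≈ 0#
  Σ<-zero zero    f≈0 = refl
  Σ<-zero (suc n) f≈0 = trans (+-cong (Σ<-zero n (f≈0 ∘ ℕ.m<n⇒m<1+n)) (f≈0 (ℕ.n<1+n n))) (+-identityʳ 0#)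

  Σ<-distrib-+ : ∀ n (f g : ℕ → Carrier) → Σ< n (λ i → f i + g i) ≈ Σ< n f + Σ< n g
  Σ<-distrib-+ zero    f g = sym (+-identityʳ 0#)
  Σ<-distrib-+ (suc n) f g = trans (+-congʳ (Σ<-distrib-+ n f g)) (interchange _ _ _ _)

  *-distribˡ-Σ< : ∀ a n (f : ℕ → Carrier) → a * Σ< n f ≈ Σ< n (λ i → a * f i)
  *-distribˡ-Σ< a zero    f = zeroʳ a
  *-distribˡ-Σ< a (suc n) f = trans (distribˡ a _ _) (+-congʳ (*-distribˡ-Σ< a n f))

  Σ<-head : ∀ n (f : ℕ → Carrier) → Σ< (suc n) f ≈ f 0 + Σ< n (λ i → f (suc i))
  Σ<-head zero    f = trans (+-identityˡ _) (sym (+-identityʳ _))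
  Σ<-head (suc n) f = trans (+-congʳ (Σ<-head n f)) (+-assoc _ _ _)

  Σ<-telescope : ∀ n (f : ℕ → Carrier) → Σ< n (λ i → f (suc i) - f i) ≈ f n - f 0
  Σ<-telescope zero    f = sym (-‿inverseʳ (f 0))
  Σ<-telescope (suc n) f = begin
    Σ< n (λ i → f (suc i) - f i) + (f (suc n) - f n)  ≈⟨ +-congʳ (Σ<-telescope n f) ⟩
    (f n - f 0) + (f (suc n) - f n)                   ≈⟨ solve 3 (λ a b c → (a :- b) :+ (c :- a) := c :- b) refl
                                                                 (f n) (f 0) (f (suc n)) ⟩
    f (suc n) - f 0                                   ∎

  Σ<-rotate : ∀ n (f : ℕ → Carrier) → f n ≈ f 0 → Σ< n (λ i → f (suc i)) ≈ Σ< n f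
  Σ<-rotate n f fn≈f0 = +-cancelˡ (f 0) _ _ (begin
    f 0 + Σ< n (λ i → f (suc i))  ≈⟨ Σ<-head n f ⟨
    Σ< n f + f n                  ≈⟨ +-congˡ fn≈f0 ⟩
    Σ< n f + f 0                  ≈⟨ +-comm _ _ ⟩
    f 0 + Σ< n f                  ∎)

  geometric-sum : ∀ y m → (y - 1#) * Σ< m (pow y) ≈ pow y m - 1#
  geometric-sum y zero    = trans (zeroʳ _) (sym (-‿inverseʳ 1#))
  geometric-sum y (suc m) = begin
    (y - 1#) * (Σ< m (pow y) + pow y m)             ≈⟨ distribˡ _ _ _ ⟩
    (y - 1#) * Σ< m (pow y) + (y - 1#) * pow y m    ≈⟨ +-congʳ (geometric-sum y m) ⟩
    (pow y m - 1#) + (y - 1#) * pow y m             ≈⟨ solve 2 (λ y u → (u :- con 1ℤ) :+ (y :- con 1ℤ) :* u := y :* u :- con 1ℤ)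
                                                               refl y (pow y m) ⟩
    y * pow y m - 1#                                ∎

  sumL-cong : ∀ {f g : Carrier → Carrier} xs → (∀ {t} → t ∈ xs → f t ≈ g t) → sumL (map f xs) ≈ sumL (map g xs)
  sumL-cong []       f≈g = refl
  sumL-cong (x ∷ xs) f≈g = +-cong (f≈g (here refl)) (sumL-cong xs (f≈g ∘ there))

  sumL-zero : ∀ {f : Carrier → Carrier} xs → (∀ {t} → t ∈ xs → f t ≈ 0#) → sumL (map f xs) ≈ 0#
  sumL-zero []       f≈0 = refl
  sumL-zero (x ∷ xs) f≈0 = trans (+-cong (f≈0 (here refl)) (sumL-zero xs (f≈0 ∘ there))) (+-identityʳ 0#)

  sumL-distrib-+ : ∀ (f g : Carrier → Carrier) xs →
                   sumL (map (λ t → f t + g t) xs) ≈ sumL (map f xs) + sumL (map g xs)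
  sumL-distrib-+ f g []       = sym (+-identityʳ 0#)
  sumL-distrib-+ f g (x ∷ xs) = trans (+-congˡ (sumL-distrib-+ f g xs)) (interchange _ _ _ _)

  *-distribˡ-sumL : ∀ a (f : Carrier → Carrier) xs → a * sumL (map f xs) ≈ sumL (map (λ t → a * f t) xs)
  *-distribˡ-sumL a f []       = zeroʳ a
  *-distribˡ-sumL a f (x ∷ xs) = trans (distribˡ a _ _) (+-congˡ (*-distribˡ-sumL a f xs))

  sumL-Σ<-comm : ∀ n (h : Carrier → ℕ → Carrier) xs →
                 sumL (map (λ t → Σ< n (h t)) xs) ≈ Σ< n (λ i → sumL (map (λ t → h t i) xs))
  sumL-Σ<-comm zero    h xs = sumL-zero xs (λ _ → refl)
  sumL-Σ<-comm (suc n) h xs =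
    trans (sumL-distrib-+ (λ t → Σ< n (h t)) (λ t → h t n) xs) (+-congʳ (sumL-Σ<-comm n h xs))

  sumL-const : ∀ a (xs : List Carrier) → sumL (map (λ _ → a) xs) ≈ length xs × a
  sumL-const a []       = refl
  sumL-const a (x ∷ xs) = +-congˡ (sumL-const a xs)

  sum-toℕ : ∀ n (h : ℕ → Carrier) → sum {n} (λ k → h (toℕ k)) ≈ Σ< n h
  sum-toℕ zero    h = refl
  sum-toℕ (suc n) h = trans (+-congˡ (sum-toℕ n (λ i → h (suc i)))) (sym (Σ<-head n h))

  sumL-↭ : ∀ {xs ys} → xs ↭ ys → sumL xs ≈ sumL ys
  sumL-↭ {xs} {ys} xs↭ys = begin
    sumL xs           ≡⟨ sumL≡foldr xs ⟩
    foldr _+_ 0# xs   ≈⟨ ↭.foldr-commMonoid +-isCommutativeMonoid xs↭ys ⟩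
    foldr _+_ 0# ys   ≡⟨ sumL≡foldr ys ⟨
    sumL ys           ∎
    where
    sumL≡foldr : ∀ xs → sumL xs ≡ foldr _+_ 0# xs
    sumL≡foldr []       = ≡.refl
    sumL≡foldr (x ∷ xs) = ≡.cong (x +_) (sumL≡foldr xs)

  unique-⊆⇒↭ : ∀ {xs ys} → Unique xs → Unique ys → xs ⊆ ys → ys ⊆ xs → xs ↭ ys
  unique-⊆⇒↭ {[]}     {[]}     _ _ _ _     = ↭-refl
  unique-⊆⇒↭ {[]}     {y ∷ ys} _ _ _ ys⊆[] = contradiction (ys⊆[] (here refl)) λ ()
  unique-⊆⇒↭ {x ∷ xs} {ys} x∷xs!@(_ ∷ xs!) ys! xs⊆ys ys⊆xs
    with as , bs , w , x≈w , ys≋ ← ∈-∃++ setoid (xs⊆ys (here refl)) =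
    ↭-trans (prep x≈w (unique-⊆⇒↭ xs! zs! xs⊆zs zs⊆xs)) (↭-sym ys↭w∷zs)
    where
    zs = as ++ bs
    ys↭w∷zs : ys ↭ w ∷ zs
    ys↭w∷zs = ↭-trans (↭-reflexive-≋ ys≋) (↭.shift refl as bs)
    w∷zs! : Unique (w ∷ zs)
    w∷zs! = ↭.Unique-resp-↭ ys↭w∷zs ys!
    zs! : Unique zs
    zs! with _ ∷ zs! ← w∷zs! = zs!
    xs⊆zs : xs ⊆ zs
    xs⊆zs z∈xs with ↭.∈-resp-↭ ys↭w∷zs (xs⊆ys (there z∈xs))
    ... | here z≈w   = contradiction (∈-resp-≈ setoid (trans z≈w (sym x≈w)) z∈xs) (Unique[x∷xs]⇒x∉xs setoid x∷xs!)
    ... | there z∈zs = z∈zs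
    zs⊆xs : zs ⊆ xs
    zs⊆xs z∈zs with ys⊆xs (↭.∈-resp-↭ (↭-sym ys↭w∷zs) (there z∈zs))
    ... | here z≈x   = contradiction (∈-resp-≈ setoid (trans z≈x x≈w) z∈zs) (Unique[x∷xs]⇒x∉xs setoid w∷zs!)
    ... | there z∈xs = z∈xs

  module _ {σ τ : Carrier → Carrier} (σ-cong : Congruent₁ _≈_ σ) (τ-cong : Congruent₁ _≈_ τ)
           (τσ≈id : ∀ x → τ (σ x) ≈ x) (στ≈id : ∀ x → σ (τ x) ≈ x)
           {xs} (xs! : Unique xs) (σ-closed : ∀ {x} → x ∈ xs → σ x ∈ xs) (τ-closed : ∀ {x} → x ∈ xs → τ x ∈ xs)
           where

    map-bijection-↭ : map σ xs ↭ xs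
    map-bijection-↭ = unique-⊆⇒↭ σxs! xs! σxs⊆xs xs⊆σxs
      where
      σxs! : Unique (map σ xs)
      σxs! = Unique!.map⁺ setoid setoid (λ {x} {y} σx≈σy → begin
        x         ≈⟨ τσ≈id x ⟨
        τ (σ x)   ≈⟨ τ-cong σx≈σy ⟩
        τ (σ y)   ≈⟨ τσ≈id y ⟩
        y         ∎) xs!
      σxs⊆xs : map σ xs ⊆ xs
      σxs⊆xs z∈σxs with x , x∈xs , z≈σx ← ∈-map⁻ setoid setoid z∈σxs = ∈-resp-≈ setoid (sym z≈σx) (σ-closed x∈xs)
      xs⊆σxs : xs ⊆ map σ xs
      xs⊆σxs {z} z∈xs = ∈-resp-≈ setoid (στ≈id z) (∈-map⁺ setoid setoid σ-cong (τ-closed z∈xs))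

    sumL-reindex : ∀ (h : Carrier → Carrier) → Congruent₁ _≈_ h → sumL (map (λ t → h (σ t)) xs) ≈ sumL (map h xs)
    sumL-reindex h h-cong = begin
      sumL (map (h ∘ σ) xs)     ≡⟨ ≡.cong sumL (List.map-∘ xs) ⟩
      sumL (map h (map σ xs))   ≈⟨ sumL-↭ (↭.map⁺ setoid h-cong map-bijection-↭) ⟩
      sumL (map h xs)           ∎

  -- Powers, the binomial theorem and the Frobenius map

  pow≡^ : ∀ x n → pow x n ≡ x Exp.^ n
  pow≡^ x zero    = ≡.refl
  pow≡^ x (suc n) = ≡.cong (x *_) (pow≡^ x n)

  pow-cong : ∀ n {x y} → x ≈ y → pow x n ≈ pow y n
  pow-cong zero    _   = refl
  pow-cong (suc n) x≈y = *-cong x≈y (pow-cong n x≈y)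

  pow-+ : ∀ x m n → pow x (m ℕ.+ n) ≈ pow x m * pow x n
  pow-+ x m n rewrite pow≡^ x (m ℕ.+ n) | pow≡^ x m | pow≡^ x n = Exp.^-homo-* x m n

  pow-* : ∀ x m n → pow x (m ℕ.* n) ≈ pow (pow x m) n
  pow-* x m n rewrite pow≡^ (pow x m) n | pow≡^ x m | pow≡^ x (m ℕ.* n) = sym (Exp.^-assocʳ x m n)

  pow-distrib-* : ∀ x y n → pow (x * y) n ≈ pow x n * pow y n
  pow-distrib-* x y n rewrite pow≡^ (x * y) n | pow≡^ x n | pow≡^ y n = CExp.^-distrib-* x y n

  pow-1# : ∀ n → pow 1# n ≈ 1#
  pow-1# zero    = refl
  pow-1# (suc n) = trans (*-identityˡ _) (pow-1# n)

  ×≈×1* : ∀ m x → m × x ≈ (m × 1#) * x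
  ×≈×1* m x = sym (trans (×-assoc-* m 1# x) (×-congʳ m (*-identityˡ x)))

  ×1-^ : ∀ m e → (m ^ e) × 1# ≈ pow (m × 1#) e
  ×1-^ m zero    = +-identityʳ 1#
  ×1-^ m (suc e) = trans (×1-homo-* m (m ^ e)) (*-congˡ (×1-^ m e))

  ∣⇒×≈0 : ∀ {p m} → p × 1# ≈ 0# → p ∣ m → ∀ x → m × x ≈ 0#
  ∣⇒×≈0 {p} p×1≈0 (divides d ≡.refl) x = begin
    (d ℕ.* p) × x               ≈⟨ ×≈×1* (d ℕ.* p) x ⟩
    ((d ℕ.* p) × 1#) * x        ≈⟨ *-congʳ (×1-homo-* d p) ⟩
    ((d × 1#) * (p × 1#)) * x   ≈⟨ *-congʳ (trans (*-congˡ p×1≈0) (zeroʳ _)) ⟩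
    0# * x                      ≈⟨ zeroˡ x ⟩
    0#                          ∎

  binomial-theorem : ∀ n x y → pow (x + y) n ≈ Σ< (suc n) (λ k → (n C k) × (pow x k * pow y (n ∸ k)))
  binomial-theorem n x y = begin
    pow (x + y) n     ≡⟨ pow≡^ (x + y) n ⟩
    (x + y) Exp.^ n   ≈⟨ Binomial.theorem n x y ⟩
    _                 ≈⟨ sum-toℕ (suc n) (λ k → (n C k) × (x Exp.^ k * y Exp.^ (n ∸ k))) ⟩
    Σ< (suc n) (λ k → (n C k) × (x Exp.^ k * y Exp.^ (n ∸ k)))
      ≈⟨ Σ<-cong (suc n) (λ {k} _ → ×-congʳ (n C k) (reflexive (≡.sym (≡.cong₂ _*_ (pow≡^ x k) (pow≡^ y (n ∸ k)))))) ⟩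
    Σ< (suc n) (λ k → (n C k) × (pow x k * pow y (n ∸ k)))   ∎

  Additive : ℕ → Set (c ⊔ ℓ)
  Additive e = ∀ x y → pow (x + y) e ≈ pow x e + pow y e

  frobenius : ∀ {p} → Prime p → p × 1# ≈ 0# → Additive p
  frobenius {zero}  p-prime = contradiction (ℕ.nonTrivial⇒n>1 0 ⦃ prime⇒nonTrivial p-prime ⦄) λ ()
  frobenius {suc m} p-prime p×1≈0 x y = begin
    pow (x + y) (suc m)                           ≈⟨ binomial-theorem (suc m) x y ⟩
    Σ< (suc m) T + T (suc m)                      ≈⟨ +-congʳ (Σ<-head m T) ⟩
    (T 0 + Σ< m (λ j → T (suc j))) + T (suc m)    ≈⟨ +-cong (+-cong T₀ (Σ<-zero m middle)) Tₚ ⟩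
    (pow y (suc m) + 0#) + pow x (suc m)          ≈⟨ trans (+-congʳ (+-identityʳ _)) (+-comm _ _) ⟩
    pow x (suc m) + pow y (suc m)                 ∎
    where
    T : ℕ → Carrier
    T k = (suc m C k) × (pow x k * pow y (suc m ∸ k))
    T₀ : T 0 ≈ pow y (suc m)
    T₀ = trans (+-identityʳ _) (*-identityˡ _)
    Tₚ : T (suc m) ≈ pow x (suc m)
    Tₚ = begin
      (suc m C suc m) × (pow x (suc m) * pow y (m ∸ m))
        ≡⟨ ≡.cong₂ (λ a b → a × (pow x (suc m) * pow y b)) (nCn≡1 (suc m)) (ℕ.n∸n≡0 m) ⟩
      1 × (pow x (suc m) * 1#)
        ≈⟨ trans (+-identityʳ _) (*-identityʳ _) ⟩
      pow x (suc m) ∎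
    middle : ∀ {j} → j ℕ.< m → T (suc j) ≈ 0#
    middle j<m = ∣⇒×≈0 p×1≈0 (p∣pCk p-prime (ℕ.s≤s ℕ.z≤n) (ℕ.s≤s j<m)) _

  additive-* : ∀ {a b} → Additive a → Additive b → Additive (a ℕ.* b)
  additive-* {a} {b} additive-a additive-b x y = begin
    pow (x + y) (a ℕ.* b)               ≈⟨ pow-* (x + y) a b ⟩
    pow (pow (x + y) a) b               ≈⟨ pow-cong b (additive-a x y) ⟩
    pow (pow x a + pow y a) b           ≈⟨ additive-b _ _ ⟩
    pow (pow x a) b + pow (pow y a) b   ≈⟨ +-cong (pow-* x a b) (pow-* y a b) ⟨
    pow x (a ℕ.* b) + pow y (a ℕ.* b)   ∎

  additive-^ : ∀ {p} → Prime p → p × 1# ≈ 0# → ∀ j → Additive (p ^ j)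
  additive-^     p-prime p×1≈0 zero    x y = trans (*-identityʳ _) (+-cong (sym (*-identityʳ x)) (sym (*-identityʳ y)))
  additive-^ {p} p-prime p×1≈0 (suc j) = additive-* {p} (frobenius p-prime p×1≈0) (additive-^ p-prime p×1≈0 j)

  module _ {e} (additive : Additive e) where

    additive-0# : pow 0# e ≈ 0#
    additive-0# = x+x≈x⇒x≈0 _ (trans (sym (additive 0# 0#)) (pow-cong e (+-identityʳ 0#)))

    additive-neg : ∀ x → pow (- x) e ≈ - pow x e
    additive-neg x = +-inverseˡ-unique _ _ (begin
      pow (- x) e + pow x e   ≈⟨ additive (- x) x ⟨
      pow (- x + x) e         ≈⟨ pow-cong e (-‿inverseˡ x) ⟩
      pow 0# e                ≈⟨ additive-0# ⟩
      0#                      ∎)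

    additive-sub : ∀ x y → pow (x - y) e ≈ pow x e - pow y e
    additive-sub x y = trans (additive x (- y)) (+-congˡ (additive-neg y))

    additive-Σ< : ∀ n (f : ℕ → Carrier) → pow (Σ< n f) e ≈ Σ< n (λ i → pow (f i) e)
    additive-Σ< zero    f = additive-0#
    additive-Σ< (suc n) f = trans (additive (Σ< n f) (f n)) (+-congʳ (additive-Σ< n f))

  inv : ∀ x → x ≉ 0# → Carrier
  inv x x≉0 = proj₁ (inverse x x≉0)

  *-inverseʳ : ∀ x (x≉0 : x ≉ 0#) → x * inv x x≉0 ≈ 1#
  *-inverseʳ x x≉0 = proj₂ (inverse x x≉0)

  *-inverseˡ : ∀ x (x≉0 : x ≉ 0#) → inv x x≉0 * x ≈ 1#
  *-inverseˡ x x≉0 = trans (*-comm _ _) (*-inverseʳ x x≉0)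

  inv-cancelˡ : ∀ x (x≉0 : x ≉ 0#) y → inv x x≉0 * (x * y) ≈ y
  inv-cancelˡ x x≉0 y = trans (sym (*-assoc _ _ _)) (trans (*-congʳ (*-inverseˡ x x≉0)) (*-identityˡ y))

  inv-cancelʳ : ∀ x (x≉0 : x ≉ 0#) y → x * (inv x x≉0 * y) ≈ y
  inv-cancelʳ x x≉0 y = trans (sym (*-assoc _ _ _)) (trans (*-congʳ (*-inverseʳ x x≉0)) (*-identityˡ y))

  inv-≉0 : ∀ x (x≉0 : x ≉ 0#) → inv x x≉0 ≉ 0#
  inv-≉0 x x≉0 x⁻¹≈0 = 1≉0 (trans (sym (*-inverseˡ x x≉0)) (trans (*-congʳ x⁻¹≈0) (zeroˡ x)))

  x*y≈0⇒y≈0 : ∀ {x y} → x ≉ 0# → x * y ≈ 0# → y ≈ 0#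
  x*y≈0⇒y≈0 {x} {y} x≉0 xy≈0 = trans (sym (inv-cancelˡ x x≉0 y)) (trans (*-congˡ xy≈0) (zeroʳ _))

  *-≉0 : ∀ {x y} → x ≉ 0# → y ≉ 0# → x * y ≉ 0#
  *-≉0 x≉0 y≉0 xy≈0 = y≉0 (x*y≈0⇒y≈0 x≉0 xy≈0)

  pow≈0⇒≈0 : ∀ {x} m → pow x m ≈ 0# → x ≈ 0#
  pow≈0⇒≈0     zero    1≈0   = contradiction 1≈0 1≉0
  pow≈0⇒≈0 {x} (suc m) xxᵐ≈0 with x ≟ 0#
  ... | yes x≈0 = x≈0
  ... | no  x≉0 = pow≈0⇒≈0 m (x*y≈0⇒y≈0 x≉0 xxᵐ≈0)

  a*s≈s⇒[a-1]s≈0 : ∀ {a s} → a * s ≈ s → (a - 1#) * s ≈ 0#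
  a*s≈s⇒[a-1]s≈0 {a} {s} as≈s =
    trans (solve 2 (λ a s → (a :- con 1ℤ) :* s := a :* s :- s) refl a s) (x≈y⇒x∙y⁻¹≈ε as≈s)

  a*s≈s⇒s≈0 : ∀ {a s} → a ≉ 1# → a * s ≈ s → s ≈ 0#
  a*s≈s⇒s≈0 a≉1 as≈s = x*y≈0⇒y≈0 (a≉1 ∘ x∙y⁻¹≈ε⇒x≈y _ _) (a*s≈s⇒[a-1]s≈0 as≈s)

  a*s≈s⇒a≈1 : ∀ {a s} → s ≉ 0# → a * s ≈ s → a ≈ 1#
  a*s≈s⇒a≈1 s≉0 as≈s = x∙y⁻¹≈ε⇒x≈y _ _ (x*y≈0⇒y≈0 s≉0 (trans (*-comm _ _) (a*s≈s⇒[a-1]s≈0 as≈s)))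

  -- Polynomials as coefficient lists, and the root bound

  eval : List Carrier → Carrier → Carrier
  eval []       x = 0#
  eval (a ∷ as) x = a + x * eval as x

  -- The quotient of as by X - r, by synthetic division.
  quotient : Carrier → List Carrier → List Carrier
  quotient r []           = []
  quotient r (a ∷ [])     = []
  quotient r (a ∷ b ∷ as) = eval (b ∷ as) r ∷ quotient r (b ∷ as)

  eval-quotient : ∀ r as x → eval as x ≈ (x - r) * eval (quotient r as) x + eval as r
  eval-quotient r []           x = solve 2 (λ x r → con 0ℤ := (x :- r) :* con 0ℤ :+ con 0ℤ) refl x r
  eval-quotient r (a ∷ [])     x = solve 3 (λ x r a → a :+ x :* con 0ℤ := (x :- r) :* con 0ℤ :+ (a :+ r :* con 0ℤ)) refl x r a
  eval-quotient r (a ∷ b ∷ as) x = begin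
    a + x * eval (b ∷ as) x
      ≈⟨ +-congˡ (*-congˡ (eval-quotient r (b ∷ as) x)) ⟩
    a + x * ((x - r) * eval (quotient r (b ∷ as)) x + eval (b ∷ as) r)
      ≈⟨ solve 5 (λ x r a u v → a :+ x :* ((x :- r) :* v :+ u) := (x :- r) :* (u :+ x :* v) :+ (a :+ r :* u))
                 refl x r a (eval (b ∷ as) r) (eval (quotient r (b ∷ as)) x) ⟩
    (x - r) * (eval (b ∷ as) r + x * eval (quotient r (b ∷ as)) x) + (a + r * eval (b ∷ as) r) ∎

  length-quotient : ∀ r a as → length (quotient r (a ∷ as)) ≡ length as
  length-quotient r a []       = ≡.refl
  length-quotient r a (b ∷ as) = ≡.cong suc (length-quotient r b as)

  quotient≈0⇒≈0 : ∀ r as → All (_≈ 0#) (quotient r as) → eval as r ≈ 0# → All (_≈ 0#) as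
  quotient≈0⇒≈0 r []           _                  _      = []
  quotient≈0⇒≈0 r (a ∷ [])     _                  a≈0    = trans (sym (trans (+-congˡ (zeroʳ r)) (+-identityʳ a))) a≈0 ∷ []
  quotient≈0⇒≈0 r (a ∷ b ∷ as) (bas≈0 ∷ quot≈0) eval≈0 = a≈0 ∷ quotient≈0⇒≈0 r (b ∷ as) quot≈0 bas≈0
    where
    a≈0 : a ≈ 0#
    a≈0 = begin
      a                         ≈⟨ trans (+-congˡ (trans (*-congˡ bas≈0) (zeroʳ r))) (+-identityʳ a) ⟨
      a + r * eval (b ∷ as) r   ≈⟨ eval≈0 ⟩
      0#                        ∎

  root-bound : ∀ as {xs} → Unique xs → length as ℕ.≤ length xs → All (λ x → eval as x ≈ 0#) xs → All (_≈ 0#) as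
  root-bound []       _                 _           _                = []
  root-bound (a ∷ as) {r ∷ xs} (r∉xs ∷ xs!) (ℕ.s≤s |as|≤|xs|) (r-root ∷ roots) = quotient≈0⇒≈0 r (a ∷ as)
    (root-bound (quotient r (a ∷ as)) xs! (≡.subst (ℕ._≤ length xs) (≡.sym (length-quotient r a as)) |as|≤|xs|)
      (All.zipWith (λ (r≉x , x-root) → quotient-root r≉x x-root) (r∉xs , roots)))
    r-root
    where
    quotient-root : ∀ {x} → r ≉ x → eval (a ∷ as) x ≈ 0# → eval (quotient r (a ∷ as)) x ≈ 0#
    quotient-root {x} r≉x x-root = x*y≈0⇒y≈0 (λ x-r≈0 → r≉x (sym (x∙y⁻¹≈ε⇒x≈y x r x-r≈0))) (begin
      (x - r) * eval (quotient r (a ∷ as)) x                     ≈⟨ trans (+-congˡ r-root) (+-identityʳ _) ⟨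
      (x - r) * eval (quotient r (a ∷ as)) x + eval (a ∷ as) r   ≈⟨ eval-quotient r (a ∷ as) x ⟨
      eval (a ∷ as) x                                            ≈⟨ x-root ⟩
      0#                                                         ∎)

  _⊕_ : List Carrier → List Carrier → List Carrier
  []       ⊕ bs       = bs
  (a ∷ as) ⊕ []       = a ∷ as
  (a ∷ as) ⊕ (b ∷ bs) = a + b ∷ as ⊕ bs

  eval-⊕ : ∀ as bs x → eval (as ⊕ bs) x ≈ eval as x + eval bs x
  eval-⊕ []       bs       x = sym (+-identityˡ _)
  eval-⊕ (a ∷ as) []       x = sym (+-identityʳ _)
  eval-⊕ (a ∷ as) (b ∷ bs) x = begin
    (a + b) + x * eval (as ⊕ bs) x              ≈⟨ +-congˡ (*-congˡ (eval-⊕ as bs x)) ⟩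
    (a + b) + x * (eval as x + eval bs x)       ≈⟨ solve 5 (λ a b x u v → (a :+ b) :+ x :* (u :+ v) := (a :+ x :* u) :+ (b :+ x :* v))
                                                            refl a b x (eval as x) (eval bs x) ⟩
    (a + x * eval as x) + (b + x * eval bs x)   ∎

  length-⊕ : ∀ as bs {n} → length as ℕ.≤ n → length bs ℕ.≤ n → length (as ⊕ bs) ℕ.≤ n
  length-⊕ []       bs       _              |bs|≤n         = |bs|≤n
  length-⊕ (a ∷ as) []       |as|≤n         _              = |as|≤n
  length-⊕ (a ∷ as) (b ∷ bs) (ℕ.s≤s |as|≤n) (ℕ.s≤s |bs|≤n) = ℕ.s≤s (length-⊕ as bs |as|≤n |bs|≤n)

  monomial : Carrier → ℕ → List Carrier
  monomial a zero    = a ∷ []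
  monomial a (suc e) = 0# ∷ monomial a e

  eval-monomial : ∀ a e x → eval (monomial a e) x ≈ a * pow x e
  eval-monomial a zero    x = solve 2 (λ a x → a :+ x :* con 0ℤ := a :* con 1ℤ) refl a x
  eval-monomial a (suc e) x = begin
    0# + x * eval (monomial a e) x   ≈⟨ +-congˡ (*-congˡ (eval-monomial a e x)) ⟩
    0# + x * (a * pow x e)           ≈⟨ solve 3 (λ a x u → con 0ℤ :+ x :* (a :* u) := a :* (x :* u)) refl a x (pow x e) ⟩
    a * (x * pow x e)                ∎

  length-monomial : ∀ a e → length (monomial a e) ≡ suc e
  length-monomial a zero    = ≡.refl
  length-monomial a (suc e) = ≡.cong suc (length-monomial a e)

  sparse : ℕ → (ℕ → Carrier) → (ℕ → ℕ) → List Carrier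
  sparse zero    a e = []
  sparse (suc r) a e = sparse r a e ⊕ monomial (a r) (e r)

  eval-sparse : ∀ r a e x → eval (sparse r a e) x ≈ Σ< r (λ l → a l * pow x (e l))
  eval-sparse zero    a e x = refl
  eval-sparse (suc r) a e x =
    trans (eval-⊕ (sparse r a e) (monomial (a r) (e r)) x) (+-cong (eval-sparse r a e x) (eval-monomial (a r) (e r) x))

  length-sparse : ∀ r a e {n} → (∀ {l} → l ℕ.< r → e l ℕ.< n) → length (sparse r a e) ℕ.≤ n
  length-sparse zero    a e _   = ℕ.z≤n
  length-sparse (suc r) a e e<n = length-⊕ (sparse r a e) (monomial (a r) (e r))
    (length-sparse r a e (e<n ∘ ℕ.m<n⇒m<1+n))
    (≡.subst (ℕ._≤ _) (≡.sym (length-monomial (a r) (e r))) (e<n (ℕ.n<1+n r)))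

  -- The constant term 1 keeps the polynomial nonzero, so the root bound applies.
  nonvanishing : ∀ r a e {xs} → Unique xs → 0 ℕ.< length xs → (∀ {l} → l ℕ.< r → suc (e l) ℕ.< length xs) →
                 ¬ All (λ x → 1# + x * Σ< r (λ l → a l * pow x (e l)) ≈ 0#) xs
  nonvanishing r a e {x ∷ xs} xs! _ deg<|xs| roots
    with 1≈0 ∷ _ ← root-bound (1# ∷ sparse r a e) xs! (ℕ.s≤s (length-sparse r a e (ℕ.s<s⁻¹ ∘ deg<|xs|)))
                     (All.map (trans (+-congˡ (*-congˡ (eval-sparse r a e _)))) roots)
    = 1≉0 1≈0

  -- Counting in a finite field

  ≉0-resp-≈ : (_≉ 0#) Respects _≈_
  ≉0-resp-≈ x≈y x≉0 y≈0 = x≉0 (trans x≈y y≈0)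

  nonzero : List Carrier → List Carrier
  nonzero = filter (λ x → ¬? (x ≟ 0#))

  ∈-nonzero⁺ : ∀ {x xs} → x ∈ xs → x ≉ 0# → x ∈ nonzero xs
  ∈-nonzero⁺ = ∈-filter⁺ setoid (λ x → ¬? (x ≟ 0#)) ≉0-resp-≈

  ∈-nonzero⁻ : ∀ xs {x} → x ∈ nonzero xs → x ≉ 0#
  ∈-nonzero⁻ xs x∈ = proj₂ (∈-filter⁻ setoid (λ x → ¬? (x ≟ 0#)) ≉0-resp-≈ {xs = xs} x∈)

  nonzero⊆ : ∀ xs → nonzero xs ⊆ xs
  nonzero⊆ xs x∈ = proj₁ (∈-filter⁻ setoid (λ x → ¬? (x ≟ 0#)) ≉0-resp-≈ {xs = xs} x∈)

  ↭-0∷nonzero : ∀ {xs} → Unique xs → 0# ∈ xs → xs ↭ 0# ∷ nonzero xs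
  ↭-0∷nonzero {xs} xs! 0∈xs = unique-⊆⇒↭ xs! 0∷nonzero! xs⊆ ⊆xs
    where
    0∷nonzero! : Unique (0# ∷ nonzero xs)
    0∷nonzero! = All.tabulateₛ setoid (λ x∈ 0≈x → ∈-nonzero⁻ xs x∈ (sym 0≈x)) ∷ Unique!.filter⁺ setoid _ xs!
    xs⊆ : xs ⊆ 0# ∷ nonzero xs
    xs⊆ {x} x∈xs with x ≟ 0#
    ... | yes x≈0 = here x≈0
    ... | no  x≉0 = there (∈-nonzero⁺ x∈xs x≉0)
    ⊆xs : 0# ∷ nonzero xs ⊆ xs
    ⊆xs (here x≈0) = ∈-resp-≈ setoid (sym x≈0) 0∈xs
    ⊆xs (there x∈) = nonzero⊆ xs x∈

  length×1≈0 : ∀ {xs} → Unique xs → (∀ {x} → x ∈ xs → x + 1# ∈ xs) → (∀ {x} → x ∈ xs → x - 1# ∈ xs) →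
               length xs × 1# ≈ 0#
  length×1≈0 {xs} xs! +1-closed -1-closed = +-identityʳ-unique (sumL (map (λ t → t) xs)) _ (begin
    sumL (map (λ t → t) xs) + length xs × 1#
      ≈⟨ +-congˡ (sumL-const 1# xs) ⟨
    sumL (map (λ t → t) xs) + sumL (map (λ _ → 1#) xs)
      ≈⟨ sumL-distrib-+ (λ t → t) (λ _ → 1#) xs ⟨
    sumL (map (λ t → t + 1#) xs)
      ≈⟨ sumL-reindex +-congʳ +-congʳ [x+1]-1≈x [x-1]+1≈x xs! +1-closed -1-closed (λ t → t) (λ t≈u → t≈u) ⟩
    sumL (map (λ t → t) xs) ∎)
    where
    [x+1]-1≈x : ∀ x → x + 1# - 1# ≈ x
    [x+1]-1≈x x = solve 1 (λ x → x :+ con 1ℤ :- con 1ℤ := x) refl x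
    [x-1]+1≈x : ∀ x → x - 1# + 1# ≈ x
    [x-1]+1≈x x = solve 1 (λ x → x :- con 1ℤ :+ con 1ℤ := x) refl x

  characteristic : length elements × 1# ≈ 0#
  characteristic = length×1≈0 unique (λ _ → complete _) (λ _ → complete _)

  units : List Carrier
  units = nonzero elements

  length-elements : length elements ≡ suc (length units)
  length-elements = ↭.xs↭ys⇒|xs|≡|ys| (↭-0∷nonzero unique (complete 0#))

  prodL : List Carrier → Carrier
  prodL = foldr _*_ 1#

  prodL-scale : ∀ x ys → prodL (map (x *_) ys) ≈ pow x (length ys) * prodL ys
  prodL-scale x []       = sym (*-identityʳ 1#)
  prodL-scale x (y ∷ ys) = begin
    x * y * prodL (map (x *_) ys)            ≈⟨ *-congˡ (prodL-scale x ys) ⟩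
    x * y * (pow x (length ys) * prodL ys)   ≈⟨ solve 4 (λ x y u v → x :* y :* (u :* v) := x :* u :* (y :* v))
                                                        refl x y (pow x (length ys)) (prodL ys) ⟩
    x * pow x (length ys) * (y * prodL ys)   ∎

  prodL-≉0 : ∀ {ys} → (∀ {y} → y ∈ ys → y ≉ 0#) → prodL ys ≉ 0#
  prodL-≉0 {[]}     _   = 1≉0
  prodL-≉0 {y ∷ ys} ≉0 = *-≉0 (≉0 (here refl)) (prodL-≉0 (≉0 ∘ there))

  fermat-units : ∀ {x} → x ≉ 0# → pow x (length units) ≈ 1#
  fermat-units {x} x≉0 = a*s≈s⇒a≈1 (prodL-≉0 (∈-nonzero⁻ elements)) (begin
    pow x (length units) * prodL units   ≈⟨ prodL-scale x units ⟨
    prodL (map (x *_) units)             ≈⟨ ↭.foldr-commMonoid *-isCommutativeMonoid x*-permutes-units ⟩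
    prodL units                          ∎)
    where
    x*-permutes-units : map (x *_) units ↭ units
    x*-permutes-units = map-bijection-↭ *-congˡ *-congˡ (inv-cancelˡ x x≉0) (inv-cancelʳ x x≉0)
      (Unique!.filter⁺ setoid _ unique)
      (λ y∈ → ∈-nonzero⁺ (complete _) (*-≉0 x≉0 (∈-nonzero⁻ elements y∈)))
      (λ y∈ → ∈-nonzero⁺ (complete _) (*-≉0 (inv-≉0 x x≉0) (∈-nonzero⁻ elements y∈)))

  fermat : ∀ x → pow x (length elements) ≈ x
  fermat x rewrite length-elements with x ≟ 0#
  ... | yes x≈0 = trans (*-congʳ x≈0) (trans (zeroˡ _) (sym x≈0))
  ... | no  x≉0 = trans (*-congˡ (fermat-units x≉0)) (*-identityʳ x)

  g-cong : ∀ i q {x y} → x ≈ y → g i q x ≈ g i q y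
  g-cong i q = gF-cong (suc i) i
    where
    gF-cong : ∀ fuel i {x y} → x ≈ y → gF fuel q i x ≈ gF fuel q i y
    gF-cong zero       i _   = refl
    gF-cong (suc fuel) i x≈y with ℕ.<-cmp i (q ∸ 1)
    ... | tri< _ _ _ = refl
    ... | tri≈ _ _ _ = refl
    ... | tri> _ _ _ = +-cong (*-cong x≈y (gF-cong fuel (i ∸ q) x≈y)) (gF-cong fuel ((i ∸ q) ℕ.+ 1) x≈y)

  module PrimePowerOrder (p k q₀ n′ : ℕ) (p-prime : Prime p) (q≡p^k : 2 ℕ.+ q₀ ≡ p ^ k)
                         (|F|≡q^n : length elements ≡ (2 ℕ.+ q₀) ^ suc n′) where

    -- Writing q = 2 + q₀ and n = 1 + n′ makes q ∸ 1 = suc q₀ and Σ< n = Σ< (suc n′) compute.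
    q n : ℕ
    q = 2 ℕ.+ q₀
    n = suc n′

    p×1≈0 : p × 1# ≈ 0#
    p×1≈0 = pow≈0⇒≈0 (k ℕ.* n) (begin
      pow (p × 1#) (k ℕ.* n)   ≈⟨ ×1-^ p (k ℕ.* n) ⟨
      (p ^ (k ℕ.* n)) × 1#     ≡⟨ ≡.cong (_× 1#) p^kn≡|F| ⟩
      length elements × 1#     ≈⟨ characteristic ⟩
      0#                       ∎)
      where
      p^kn≡|F| : p ^ (k ℕ.* n) ≡ length elements
      p^kn≡|F| = ≡.trans (≡.sym (ℕ.^-*-assoc p k n)) (≡.trans (≡.cong (_^ n) (≡.sym q≡p^k)) (≡.sym |F|≡q^n))

    additive-q^ : ∀ j → Additive (q ^ j)
    additive-q^ j = ≡.subst Additive (≡.sym (≡.trans (≡.cong (_^ j) q≡p^k) (ℕ.^-*-assoc p k j)))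
                      (additive-^ p-prime p×1≈0 (k ℕ.* j))

    additive-q : Additive q
    additive-q = ≡.subst Additive (≡.sym q≡p^k) (additive-^ p-prime p×1≈0 k)

    fermat-q^n : ∀ x → pow x (q ^ n) ≈ x
    fermat-q^n x = ≡.subst (λ m → pow x m ≈ x) |F|≡q^n (fermat x)

    InFq : Carrier → Set ℓ
    InFq x = pow x q ≈ x

    InFq-resp-≈ : InFq Respects _≈_
    InFq-resp-≈ {x} {y} x≈y xᵠ≈x = trans (pow-cong q (sym x≈y)) (trans xᵠ≈x x≈y)

    ∈-Fq⁺ : ∀ {x} → InFq x → x ∈ Fq q
    ∈-Fq⁺ {x} = ∈-filter⁺ setoid (λ x → pow x q ≟ x) InFq-resp-≈ (complete x)

    ∈-Fq⁻ : ∀ {x} → x ∈ Fq q → InFq x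
    ∈-Fq⁻ x∈ = proj₂ (∈-filter⁻ setoid (λ x → pow x q ≟ x) InFq-resp-≈ {xs = elements} x∈)

    Fq! : Unique (Fq q)
    Fq! = Unique!.filter⁺ setoid _ unique

    InFq-0# : InFq 0#
    InFq-0# = zeroˡ _

    InFq-1# : InFq 1#
    InFq-1# = pow-1# q

    InFq-+ : ∀ {x y} → InFq x → InFq y → InFq (x + y)
    InFq-+ {x} {y} xᵠ≈x yᵠ≈y = trans (additive-q x y) (+-cong xᵠ≈x yᵠ≈y)

    InFq-- : ∀ {x y} → InFq x → InFq y → InFq (x - y)
    InFq-- {x} {y} xᵠ≈x yᵠ≈y = trans (additive-sub {q} additive-q x y) (+-cong xᵠ≈x (-‿cong yᵠ≈y))

    InFq-* : ∀ {x y} → InFq x → InFq y → InFq (x * y)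
    InFq-* {x} {y} xᵠ≈x yᵠ≈y = trans (pow-distrib-* x y q) (*-cong xᵠ≈x yᵠ≈y)

    InFq-inv : ∀ {x} (x≉0 : x ≉ 0#) → InFq x → InFq (inv x x≉0)
    InFq-inv {x} x≉0 xᵠ≈x = begin
      pow x⁻¹ q                     ≈⟨ inv-cancelˡ x x≉0 _ ⟨
      x⁻¹ * (x * pow x⁻¹ q)         ≈⟨ *-congˡ (*-congʳ xᵠ≈x) ⟨
      x⁻¹ * (pow x q * pow x⁻¹ q)   ≈⟨ *-congˡ (pow-distrib-* x x⁻¹ q) ⟨
      x⁻¹ * pow (x * x⁻¹) q         ≈⟨ *-congˡ (trans (pow-cong q (*-inverseʳ x x≉0)) (pow-1# q)) ⟩
      x⁻¹ * 1#                      ≈⟨ *-identityʳ x⁻¹ ⟩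
      x⁻¹                           ∎
      where x⁻¹ = inv x x≉0

    q^n≡q+[q-1]r : ∃ λ r → q ^ n ≡ q ℕ.+ suc q₀ ℕ.* r
    q^n≡q+[q-1]r = [2+a]^[1+m]≡2+a+[1+a]r q₀ n′

    r : ℕ
    r = proj₁ q^n≡q+[q-1]r

    |units|≡[q-1][r+1] : length units ≡ suc q₀ ℕ.* suc r
    |units|≡[q-1][r+1] = ℕ.suc-injective (≡.trans (≡.sym length-elements) (≡.trans |F|≡q^n
                           (≡.trans (proj₂ q^n≡q+[q-1]r) (≡.cong suc (≡.sym (ℕ.*-suc (suc q₀) r))))))

    -- Outside F_q, y = x^(q-1) ≠ 1 while y^(r+1) = x^|F*| = 1, so 1 + y + ... + y^r = 0.
    ∉Fq⇒root : ∀ {x} → ¬ InFq x → 1# + x * Σ< r (λ l → 1# * pow x (q₀ ℕ.+ suc q₀ ℕ.* l)) ≈ 0#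
    ∉Fq⇒root {x} x∉Fq = begin
      1# + x * Σ< r (λ l → 1# * pow x (q₀ ℕ.+ suc q₀ ℕ.* l))    ≈⟨ +-congˡ (*-distribˡ-Σ< x r _) ⟩
      1# + Σ< r (λ l → x * (1# * pow x (q₀ ℕ.+ suc q₀ ℕ.* l)))  ≈⟨ +-congˡ (Σ<-cong r (λ _ → term _)) ⟩
      1# + Σ< r (λ l → pow y (suc l))                           ≈⟨ Σ<-head r (pow y) ⟨
      Σ< (suc r) (pow y)                                        ≈⟨ x*y≈0⇒y≈0 y-1≉0 (trans (geometric-sum y (suc r))
                                                                                           (x≈y⇒x∙y⁻¹≈ε yʳ⁺¹≈1)) ⟩
      0#                                                        ∎
      where
      y = pow x (suc q₀)
      x≉0 : x ≉ 0#
      x≉0 x≈0 = x∉Fq (InFq-resp-≈ (sym x≈0) InFq-0#)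
      y-1≉0 : y - 1# ≉ 0#
      y-1≉0 y-1≈0 = x∉Fq (trans (*-congˡ (x∙y⁻¹≈ε⇒x≈y _ _ y-1≈0)) (*-identityʳ x))
      yʳ⁺¹≈1 : pow y (suc r) ≈ 1#
      yʳ⁺¹≈1 = begin
        pow y (suc r)                 ≈⟨ pow-* x (suc q₀) (suc r) ⟨
        pow x (suc q₀ ℕ.* suc r)      ≡⟨ ≡.cong (pow x) |units|≡[q-1][r+1] ⟨
        pow x (length units)          ≈⟨ fermat-units x≉0 ⟩
        1#                            ∎
      term : ∀ l → x * (1# * pow x (q₀ ℕ.+ suc q₀ ℕ.* l)) ≈ pow y (suc l)
      term l = begin
        x * (1# * pow x (q₀ ℕ.+ suc q₀ ℕ.* l))   ≈⟨ *-congˡ (*-identityˡ _) ⟩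
        pow x (suc q₀ ℕ.+ suc q₀ ℕ.* l)          ≡⟨ ≡.cong (pow x) (ℕ.*-suc (suc q₀) l) ⟨
        pow x (suc q₀ ℕ.* suc l)                 ≈⟨ pow-* x (suc q₀) (suc l) ⟩
        pow y (suc l)                            ∎

    q≤|Fq| : q ℕ.≤ length (Fq q)
    q≤|Fq| with q ℕ.≤? length (Fq q)
    ... | yes q≤|Fq| = q≤|Fq|
    ... | no  q≰|Fq| = contradiction (All.map ∉Fq⇒root (all-filter (∁? InFq?) elements))
      (nonvanishing r (λ _ → 1#) (λ l → q₀ ℕ.+ suc q₀ ℕ.* l) (Unique!.filter⁺ setoid _ unique)
        (ℕ.<-≤-trans (ℕ.s≤s ℕ.z≤n) |nonFq|>[q-1]r) degree<|nonFq|)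
      where
      InFq? : ∀ x → Dec (InFq x)
      InFq? x = pow x q ≟ x
      nonFq = filter (∁? InFq?) elements
      |nonFq|>[q-1]r : suc q₀ ℕ.* r ℕ.< length nonFq
      |nonFq|>[q-1]r = m+n≡1+o+p⇒p<n (≡.trans (length-filter-∁ InFq? elements) (≡.trans |F|≡q^n (proj₂ q^n≡q+[q-1]r)))
                         (ℕ.s≤s⁻¹ (ℕ.≰⇒> q≰|Fq|))
      degree<|nonFq| : ∀ {l} → l ℕ.< r → suc (q₀ ℕ.+ suc q₀ ℕ.* l) ℕ.< length nonFq
      degree<|nonFq| {l} l<r = ℕ.≤-<-trans
        (ℕ.≤-trans (ℕ.≤-reflexive (≡.sym (ℕ.*-suc (suc q₀) l))) (ℕ.*-monoʳ-≤ (suc q₀) l<r)) |nonFq|>[q-1]r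

    -- Power sums over F_q and the polynomials g_{i,q}

    powerSum : ℕ → Carrier
    powerSum j = sumL (map (λ t → pow t j) (Fq q))

    |Fq|×1≈0 : length (Fq q) × 1# ≈ 0#
    |Fq|×1≈0 = length×1≈0 Fq! (λ t∈ → ∈-Fq⁺ (InFq-+ (∈-Fq⁻ t∈) InFq-1#))
                              (λ t∈ → ∈-Fq⁺ (InFq-- (∈-Fq⁻ t∈) InFq-1#))

    powerSum-0 : powerSum 0 ≈ 0#
    powerSum-0 = trans (sumL-const 1# (Fq q)) |Fq|×1≈0

    Fq* : List Carrier
    Fq* = nonzero (Fq q)

    Fq↭0∷Fq* : Fq q ↭ 0# ∷ Fq*
    Fq↭0∷Fq* = ↭-0∷nonzero Fq! (∈-Fq⁺ InFq-0#)

    ∈-Fq*⁻ : ∀ {t} → t ∈ Fq* → InFq t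
    ∈-Fq*⁻ t∈ = ∈-Fq⁻ (nonzero⊆ (Fq q) t∈)

    InFq-≉0⇒pow≈1 : ∀ {t} → InFq t → t ≉ 0# → pow t (suc q₀) ≈ 1#
    InFq-≉0⇒pow≈1 {t} tᵠ≈t t≉0 = x∙y⁻¹≈ε⇒x≈y _ _ (x*y≈0⇒y≈0 t≉0 (begin
      t * (pow t (suc q₀) - 1#)   ≈⟨ x[y-z]≈xy-xz t _ _ ⟩
      pow t q - t * 1#            ≈⟨ +-congˡ (-‿cong (*-identityʳ t)) ⟩
      pow t q - t                 ≈⟨ x≈y⇒x∙y⁻¹≈ε tᵠ≈t ⟩
      0#                          ∎))

    powerSum-top : powerSum (suc q₀) ≈ - 1#
    powerSum-top = begin
      powerSum (suc q₀)
        ≈⟨ sumL-↭ (↭.map⁺ setoid (pow-cong (suc q₀)) Fq↭0∷Fq*) ⟩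
      pow 0# (suc q₀) + sumL (map (λ t → pow t (suc q₀)) Fq*)
        ≈⟨ +-cong (zeroˡ _) (sumL-cong Fq* (λ t∈ → InFq-≉0⇒pow≈1 (∈-Fq*⁻ t∈) (∈-nonzero⁻ (Fq q) t∈))) ⟩
      0# + sumL (map (λ _ → 1#) Fq*)
        ≈⟨ trans (+-identityˡ _) (sumL-const 1# Fq*) ⟩
      length Fq* × 1#
        ≈⟨ +-inverseʳ-unique 1# _ (trans (reflexive (≡.cong (_× 1#) (≡.sym |Fq|≡1+|Fq*|))) |Fq|×1≈0) ⟩
      - 1#
        ∎
      where
      |Fq|≡1+|Fq*| : length (Fq q) ≡ suc (length Fq*)
      |Fq|≡1+|Fq*| = ↭.xs↭ys⇒|xs|≡|ys| Fq↭0∷Fq*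

    powerSum-scale : ∀ {γ} j → InFq γ → (γ≉0 : γ ≉ 0#) → pow γ j * powerSum j ≈ powerSum j
    powerSum-scale {γ} j γ∈Fq γ≉0 = begin
      pow γ j * powerSum j                          ≈⟨ *-distribˡ-sumL (pow γ j) (λ t → pow t j) (Fq q) ⟩
      sumL (map (λ t → pow γ j * pow t j) (Fq q))   ≈⟨ sumL-cong (Fq q) (λ {t} _ → sym (pow-distrib-* γ t j)) ⟩
      sumL (map (λ t → pow (γ * t) j) (Fq q))       ≈⟨ sumL-reindex *-congˡ *-congˡ (inv-cancelˡ γ γ≉0) (inv-cancelʳ γ γ≉0) Fq!
                                                         (λ t∈ → ∈-Fq⁺ (InFq-* γ∈Fq (∈-Fq⁻ t∈)))
                                                         (λ t∈ → ∈-Fq⁺ (InFq-* (InFq-inv γ≉0 γ∈Fq) (∈-Fq⁻ t∈)))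
                                                         (λ t → pow t j) (pow-cong j) ⟩
      powerSum j                                    ∎

    -- γ^j = 1 has at most j < |F_q^*| solutions.
    ∃pow≉1 : ∀ {j} → suc j ℕ.< suc q₀ → ∃₂ λ γ (_ : γ ∈ Fq*) → pow γ (suc j) ≉ 1#
    ∃pow≉1 {j} j<q-1 = find (¬All⇒Any¬ (λ γ → pow γ (suc j) ≟ 1#) Fq* not-all-roots)
      where
      |Fq*|>j : suc j ℕ.< length Fq*
      |Fq*|>j = ℕ.<-≤-trans j<q-1 (ℕ.s≤s⁻¹ (ℕ.≤-trans q≤|Fq| (ℕ.≤-reflexive (↭.xs↭ys⇒|xs|≡|ys| Fq↭0∷Fq*))))
      1-γʲ≈0 : ∀ {γ} → pow γ (suc j) ≈ 1# → 1# + γ * Σ< 1 (λ _ → - 1# * pow γ j) ≈ 0#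
      1-γʲ≈0 {γ} γʲ≈1 = begin
        1# + γ * (0# + - 1# * pow γ j)   ≈⟨ solve 2 (λ γ u → con 1ℤ :+ γ :* (con 0ℤ :+ (:- con 1ℤ) :* u) := con 1ℤ :- γ :* u)
                                                     refl γ (pow γ j) ⟩
        1# - pow γ (suc j)               ≈⟨ x≈y⇒x∙y⁻¹≈ε (sym γʲ≈1) ⟩
        0#                               ∎
      not-all-roots : ¬ All (λ γ → pow γ (suc j) ≈ 1#) Fq*
      not-all-roots all≈1 = nonvanishing 1 (λ _ → - 1#) (λ _ → j) (Unique!.filter⁺ setoid _ Fq!)
        (ℕ.<-trans (ℕ.s≤s ℕ.z≤n) |Fq*|>j) (λ { {zero} _ → |Fq*|>j ; {suc _} (ℕ.s≤s ()) }) (All.map 1-γʲ≈0 all≈1)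

    powerSum-low : ∀ {m} → m ℕ.< suc q₀ → powerSum m ≈ 0#
    powerSum-low {zero}  _     = powerSum-0
    powerSum-low {suc j} j<q-1 with γ , γ∈Fq* , γʲ≉1 ← ∃pow≉1 j<q-1 =
      a*s≈s⇒s≈0 γʲ≉1 (powerSum-scale (suc j) (∈-Fq*⁻ γ∈Fq*) (∈-nonzero⁻ (Fq q) γ∈Fq*))

    ℘ : Carrier → Carrier
    ℘ x = pow x q - x

    shiftedPowerSum : ℕ → Carrier → Carrier
    shiftedPowerSum i x = sumL (map (λ t → pow (t + x) i) (Fq q))

    shiftedPowerSum-binomial : ∀ i x → shiftedPowerSum i x ≈ Σ< (suc i) (λ m → (i C m) × pow x (i ∸ m) * powerSum m)
    shiftedPowerSum-binomial i x = begin
      shiftedPowerSum i x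
        ≈⟨ sumL-cong (Fq q) (λ {t} _ → binomial-theorem i t x) ⟩
      sumL (map (λ t → Σ< (suc i) (λ m → T t m)) (Fq q))
        ≈⟨ sumL-Σ<-comm (suc i) T (Fq q) ⟩
      Σ< (suc i) (λ m → sumL (map (λ t → T t m) (Fq q)))
        ≈⟨ Σ<-cong (suc i) (λ {m} _ → coefficient m) ⟩
      Σ< (suc i) (λ m → (i C m) × pow x (i ∸ m) * powerSum m) ∎
      where
      T : Carrier → ℕ → Carrier
      T t m = (i C m) × (pow t m * pow x (i ∸ m))
      coefficient : ∀ m → sumL (map (λ t → T t m) (Fq q)) ≈ (i C m) × pow x (i ∸ m) * powerSum m
      coefficient m = begin
        sumL (map (λ t → T t m) (Fq q))
          ≈⟨ sumL-cong (Fq q) (λ _ → trans (×-congʳ (i C m) (*-comm _ _)) (sym (×-assoc-* (i C m) _ _))) ⟩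
        sumL (map (λ t → (i C m) × pow x (i ∸ m) * pow t m) (Fq q))
          ≈⟨ *-distribˡ-sumL _ (λ t → pow t m) (Fq q) ⟨
        (i C m) × pow x (i ∸ m) * powerSum m ∎

    shiftedPowerSum-low : ∀ {i} x → i ℕ.< suc q₀ → shiftedPowerSum i x ≈ 0#
    shiftedPowerSum-low {i} x i<q-1 = trans (shiftedPowerSum-binomial i x)
      (Σ<-zero (suc i) (λ m≤i → trans (*-congˡ (powerSum-low (ℕ.<-≤-trans m≤i i<q-1))) (zeroʳ _)))

    shiftedPowerSum-top : ∀ x → shiftedPowerSum (suc q₀) x ≈ - 1#
    shiftedPowerSum-top x = begin
      shiftedPowerSum (suc q₀) x   ≈⟨ shiftedPowerSum-binomial (suc q₀) x ⟩
      Σ< (suc q₀) T + T (suc q₀)   ≈⟨ +-cong (Σ<-zero (suc q₀) (λ m<q-1 → trans (*-congˡ (powerSum-low m<q-1)) (zeroʳ _)))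
                                              lastTerm ⟩
      0# + - 1#                    ≈⟨ +-identityˡ _ ⟩
      - 1#                         ∎
      where
      T : ℕ → Carrier
      T m = (suc q₀ C m) × pow x (suc q₀ ∸ m) * powerSum m
      lastTerm : T (suc q₀) ≈ - 1#
      lastTerm = begin
        (suc q₀ C suc q₀) × pow x (q₀ ∸ q₀) * powerSum (suc q₀)
          ≡⟨ ≡.cong₂ (λ a b → a × pow x b * powerSum (suc q₀)) (nCn≡1 (suc q₀)) (ℕ.n∸n≡0 q₀) ⟩
        (1# + 0#) * powerSum (suc q₀)
          ≈⟨ trans (*-cong (+-identityʳ 1#) powerSum-top) (*-identityˡ _) ⟩
        - 1# ∎

    shiftedPowerSum-step : ∀ {i} x → q ℕ.≤ i →
      shiftedPowerSum i x ≈ ℘ x * shiftedPowerSum (i ∸ q) x + shiftedPowerSum ((i ∸ q) ℕ.+ 1) x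
    shiftedPowerSum-step {i} x q≤i = begin
      shiftedPowerSum i x
        ≈⟨ sumL-cong (Fq q) (λ t∈ → pointwise (∈-Fq⁻ t∈)) ⟩
      sumL (map (λ t → ℘ x * pow (t + x) (i ∸ q) + pow (t + x) ((i ∸ q) ℕ.+ 1)) (Fq q))
        ≈⟨ sumL-distrib-+ _ _ (Fq q) ⟩
      sumL (map (λ t → ℘ x * pow (t + x) (i ∸ q)) (Fq q)) + shiftedPowerSum ((i ∸ q) ℕ.+ 1) x
        ≈⟨ +-congʳ (*-distribˡ-sumL (℘ x) (λ t → pow (t + x) (i ∸ q)) (Fq q)) ⟨
      ℘ x * shiftedPowerSum (i ∸ q) x + shiftedPowerSum ((i ∸ q) ℕ.+ 1) x ∎
      where
      pointwise : ∀ {t} → InFq t → pow (t + x) i ≈ ℘ x * pow (t + x) (i ∸ q) + pow (t + x) ((i ∸ q) ℕ.+ 1)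
      pointwise {t} tᵠ≈t = begin
        pow (t + x) i
          ≡⟨ ≡.cong (pow (t + x)) (ℕ.m∸n+n≡m q≤i) ⟨
        pow (t + x) ((i ∸ q) ℕ.+ q)
          ≈⟨ pow-+ (t + x) (i ∸ q) q ⟩
        pow (t + x) (i ∸ q) * pow (t + x) q
          ≈⟨ *-congˡ (trans (additive-q t x) (+-congʳ tᵠ≈t)) ⟩
        pow (t + x) (i ∸ q) * (t + pow x q)
          ≈⟨ solve 4 (λ u t x xᵠ → u :* (t :+ xᵠ) := (xᵠ :- x) :* u :+ u :* ((t :+ x) :* con 1ℤ))
                     refl (pow (t + x) (i ∸ q)) t x (pow x q) ⟩
        ℘ x * pow (t + x) (i ∸ q) + pow (t + x) (i ∸ q) * pow (t + x) 1
          ≈⟨ +-congˡ (pow-+ (t + x) (i ∸ q) 1) ⟨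
        ℘ x * pow (t + x) (i ∸ q) + pow (t + x) ((i ∸ q) ℕ.+ 1) ∎

    shiftedPowerSum≈g : ∀ i x → shiftedPowerSum i x ≈ g i q (℘ x)
    shiftedPowerSum≈g i x = go (suc i) i (ℕ.n<1+n i)
      where
      go : ∀ fuel i → i ℕ.< fuel → shiftedPowerSum i x ≈ gF fuel q i (℘ x)
      go (suc fuel) i i<1+fuel with ℕ.<-cmp i (suc q₀)
      ... | tri< i<q-1 _ _ = shiftedPowerSum-low x i<q-1
      ... | tri≈ _ ≡.refl _ = shiftedPowerSum-top x
      ... | tri> _ _ q≤i = begin
        shiftedPowerSum i x
          ≈⟨ shiftedPowerSum-step x q≤i ⟩
        ℘ x * shiftedPowerSum (i ∸ q) x + shiftedPowerSum ((i ∸ q) ℕ.+ 1) x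
          ≈⟨ +-cong (*-congˡ (go fuel (i ∸ q) i-q<fuel)) (go fuel ((i ∸ q) ℕ.+ 1) i-q+1<fuel) ⟩
        ℘ x * gF fuel q (i ∸ q) (℘ x) + gF fuel q ((i ∸ q) ℕ.+ 1) (℘ x) ∎
        where
        i-q+1<fuel : (i ∸ q) ℕ.+ 1 ℕ.< fuel
        i-q+1<fuel = ℕ.≤-trans (ℕ.≤-reflexive (≡.sym (ℕ.+-suc (i ∸ q) 1)))
          (ℕ.≤-trans (ℕ.+-monoʳ-≤ (i ∸ q) (ℕ.s≤s (ℕ.s≤s ℕ.z≤n)))
            (ℕ.≤-trans (ℕ.≤-reflexive (ℕ.m∸n+n≡m q≤i)) (ℕ.s≤s⁻¹ i<1+fuel)))
        i-q<fuel : i ∸ q ℕ.< fuel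
        i-q<fuel = ℕ.<-trans (ℕ.≤-reflexive (ℕ.+-comm 1 (i ∸ q))) i-q+1<fuel

    -- Trace and additive Hilbert 90

    pow-q^-q : ∀ x j → pow (pow x (q ^ j)) q ≈ pow x (q ^ suc j)
    pow-q^-q x j = trans (sym (pow-* x (q ^ j) q)) (reflexive (≡.cong (pow x) (ℕ.*-comm (q ^ j) q)))

    Tr-℘ : ∀ w → Tr q n (℘ w) ≈ 0#
    Tr-℘ w = begin
      Σ< n (λ j → pow (pow w q - w) (q ^ j))
        ≈⟨ Σ<-cong n (λ {j} _ → trans (additive-sub {q ^ j} (additive-q^ j) (pow w q) w) (+-congʳ (sym (pow-* w q (q ^ j))))) ⟩
      Σ< n (λ j → pow w (q ^ suc j) - pow w (q ^ j))
        ≈⟨ Σ<-telescope n (λ j → pow w (q ^ j)) ⟩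
      pow w (q ^ n) - pow w 1
        ≈⟨ +-cong (fermat-q^n w) (-‿cong (*-identityʳ w)) ⟩
      w - w
        ≈⟨ -‿inverseʳ w ⟩
      0# ∎

    Tr-InFq : ∀ z → InFq (Tr q n z)
    Tr-InFq z = begin
      pow (Σ< n (λ j → pow z (q ^ j))) q   ≈⟨ additive-Σ< {q} additive-q n _ ⟩
      Σ< n (λ j → pow (pow z (q ^ j)) q)   ≈⟨ Σ<-cong n (λ {j} _ → pow-q^-q z j) ⟩
      Σ< n (λ j → pow z (q ^ suc j))       ≈⟨ Σ<-rotate n (λ j → pow z (q ^ j)) (trans (fermat-q^n z) (sym (*-identityʳ z))) ⟩
      Σ< n (λ j → pow z (q ^ j))           ∎

    -- Tr x = x (1 + x Σ_{l<n′} x^(q^(l+1) - 2)) has degree q^n′ < |F*|, so it does not vanish on F*.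
    Tr-nonzero : ∃ λ z → Tr q n z ≉ 0#
    Tr-nonzero = z , λ Tr-z≈0 → 1+zh≉0 (x*y≈0⇒y≈0 (∈-nonzero⁻ elements z∈units) (trans (sym (Tr≈x[1+xh] z)) Tr-z≈0))
      where
      e : ℕ → ℕ
      e l = q ^ suc l ∸ 2
      h : Carrier → Carrier
      h x = Σ< n′ (λ l → 1# * pow x (e l))
      2+e≡q^[1+l] : ∀ l → 2 ℕ.+ e l ≡ q ^ suc l
      2+e≡q^[1+l] l = ℕ.m+[n∸m]≡n (ℕ.*-mono-≤ {2} {q} {1} {q ^ l} (ℕ.s≤s (ℕ.s≤s ℕ.z≤n)) (ℕ.m^n>0 q l))
      Tr≈x[1+xh] : ∀ x → Tr q n x ≈ x * (1# + x * h x)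
      Tr≈x[1+xh] x = begin
        Σ< (suc n′) (λ j → pow x (q ^ j))
          ≈⟨ Σ<-head n′ _ ⟩
        pow x 1 + Σ< n′ (λ l → pow x (q ^ suc l))
          ≈⟨ +-cong (*-identityʳ x) (Σ<-cong n′ (λ {l} _ → reflexive (≡.cong (pow x) (≡.sym (2+e≡q^[1+l] l))))) ⟩
        x + Σ< n′ (λ l → x * (x * pow x (e l)))
          ≈⟨ +-congˡ (Σ<-cong n′ (λ _ → *-congˡ (*-congˡ (sym (*-identityˡ _))))) ⟩
        x + Σ< n′ (λ l → x * (x * (1# * pow x (e l))))
          ≈⟨ +-congˡ (trans (*-congˡ (*-distribˡ-Σ< x n′ _)) (*-distribˡ-Σ< x n′ _)) ⟨
        x + x * (x * h x)
          ≈⟨ solve 2 (λ x u → x :+ x :* (x :* u) := x :* (con 1ℤ :+ x :* u)) refl x (h x) ⟩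
        x * (1# + x * h x) ∎
      q^n′≤|units| : q ^ n′ ℕ.≤ length units
      q^n′≤|units| = ℕ.s≤s⁻¹ (ℕ.≤-trans (ℕ.+-monoˡ-≤ (q ^ n′) (ℕ.m^n>0 q n′))
        (ℕ.≤-trans (ℕ.≤-reflexive (≡.cong (q ^ n′ ℕ.+_) (≡.sym (ℕ.+-identityʳ (q ^ n′)))))
          (ℕ.≤-trans (ℕ.*-monoˡ-≤ (q ^ n′) {2} {q} (ℕ.s≤s (ℕ.s≤s ℕ.z≤n)))
            (ℕ.≤-reflexive (≡.trans (≡.sym |F|≡q^n) length-elements)))))
      not-all-roots : ¬ All (λ x → 1# + x * h x ≈ 0#) units
      not-all-roots = nonvanishing n′ (λ _ → 1#) e (Unique!.filter⁺ setoid _ unique)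
        (ℕ.<-≤-trans (ℕ.m^n>0 q n′) q^n′≤|units|)
        (λ {l} l<n′ → ℕ.≤-trans (ℕ.≤-reflexive (2+e≡q^[1+l] l)) (ℕ.≤-trans (ℕ.^-monoʳ-≤ q l<n′) q^n′≤|units|))
      witness : ∃₂ λ z (_ : z ∈ units) → 1# + z * h z ≉ 0#
      witness = find (¬All⇒Any¬ (λ x → (1# + x * h x) ≟ 0#) units not-all-roots)
      z = proj₁ witness
      z∈units = proj₁ (proj₂ witness)
      1+zh≉0 = proj₂ (proj₂ witness)

    partialTr : Carrier → ℕ → Carrier
    partialTr d i = Σ< i (λ j → pow d (q ^ j))

    partialTr-pow-q : ∀ d i → pow (partialTr d i) q ≈ partialTr d (suc i) - d
    partialTr-pow-q d i = begin
      pow (partialTr d i) q                      ≈⟨ additive-Σ< {q} additive-q i _ ⟩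
      Σ< i (λ j → pow (pow d (q ^ j)) q)         ≈⟨ Σ<-cong i (λ {j} _ → pow-q^-q d j) ⟩
      Σ< i (λ j → pow d (q ^ suc j))             ≈⟨ solve 2 (λ a d → a := (d :+ a) :- d) refl (Σ< i _) d ⟩
      (d + Σ< i (λ j → pow d (q ^ suc j))) - d   ≈⟨ +-congʳ (trans (Σ<-head i _) (+-congʳ (*-identityʳ d))) ⟨
      partialTr d (suc i) - d                    ∎

    h90-element : Carrier → Carrier → Carrier
    h90-element d z = Σ< n (λ i → partialTr d i * pow z (q ^ i))

    h90-element-pow-q : ∀ {d} z → Tr q n d ≈ 0# → pow (h90-element d z) q ≈ h90-element d z - d * Tr q n z
    h90-element-pow-q {d} z Tr-d≈0 = begin
      pow w q
        ≈⟨ additive-Σ< {q} additive-q n _ ⟩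
      Σ< n (λ i → pow (s i * Z i) q)
        ≈⟨ Σ<-cong n (λ {i} _ → trans (pow-distrib-* (s i) (Z i) q) (*-cong (partialTr-pow-q d i) (pow-q^-q z i))) ⟩
      Σ< n (λ i → (s (suc i) - d) * Z (suc i))
        ≈⟨ Σ<-cong n (λ {i} _ → solve 3 (λ a d b → (a :- d) :* b := a :* b :+ (:- d) :* b) refl (s (suc i)) d (Z (suc i))) ⟩
      Σ< n (λ i → s (suc i) * Z (suc i) + - d * Z (suc i))
        ≈⟨ Σ<-distrib-+ n _ _ ⟩
      Σ< n (λ i → s (suc i) * Z (suc i)) + Σ< n (λ i → - d * Z (suc i))
        ≈⟨ +-cong (Σ<-rotate n (λ i → s i * Z i) sₙZₙ≈s₀Z₀) (sym (*-distribˡ-Σ< (- d) n _)) ⟩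
      w + - d * Σ< n (λ i → Z (suc i))
        ≈⟨ +-congˡ (*-congˡ (Σ<-rotate n Z (trans (fermat-q^n z) (sym (*-identityʳ z))))) ⟩
      w + - d * Tr q n z
        ≈⟨ +-congˡ (-‿distribˡ-* d _) ⟨
      w - d * Tr q n z ∎
      where
      s = partialTr d
      Z : ℕ → Carrier
      Z i = pow z (q ^ i)
      w = h90-element d z
      sₙZₙ≈s₀Z₀ : s n * Z n ≈ s 0 * Z 0
      sₙZₙ≈s₀Z₀ = trans (*-congʳ Tr-d≈0) (trans (zeroˡ _) (sym (zeroˡ _)))

    hilbert90 : ∀ d → Tr q n d ≈ 0# → ∃ λ w → ℘ w ≈ d
    hilbert90 d Tr-d≈0 = - τ⁻¹ * w , (begin
      pow (- τ⁻¹ * w) q - (- τ⁻¹ * w)         ≈⟨ +-congʳ (pow-distrib-* (- τ⁻¹) w q) ⟩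
      pow (- τ⁻¹) q * pow w q - (- τ⁻¹ * w)   ≈⟨ +-congʳ (*-cong [-τ⁻¹]ᵠ≈-τ⁻¹ (h90-element-pow-q z Tr-d≈0)) ⟩
      - τ⁻¹ * (w - d * τ) - (- τ⁻¹ * w)       ≈⟨ solve 4 (λ t w d τ → (:- t) :* (w :- d :* τ) :- ((:- t) :* w) := (τ :* t) :* d)
                                                         refl τ⁻¹ w d τ ⟩
      τ * τ⁻¹ * d                             ≈⟨ trans (*-congʳ (*-inverseʳ τ τ≉0)) (*-identityˡ d) ⟩
      d                                       ∎)
      where
      z = proj₁ Tr-nonzero
      τ = Tr q n z
      τ≉0 : τ ≉ 0#
      τ≉0 = proj₂ Tr-nonzero
      τ⁻¹ = inv τ τ≉0
      w = h90-element d z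
      [-τ⁻¹]ᵠ≈-τ⁻¹ : pow (- τ⁻¹) q ≈ - τ⁻¹
      [-τ⁻¹]ᵠ≈-τ⁻¹ = trans (additive-neg {q} additive-q τ⁻¹) (-‿cong (InFq-inv τ≉0 (Tr-InFq z)))

    sum-over-line : ∀ N a u v (v≉0 : v ≉ 0#) →
      sumL (map (λ t → polyFun N a (u + t * v)) (Fq q)) ≈ Σ< N (λ i → a i * pow v i * g i q (℘ (u * inv v v≉0)))
    sum-over-line N a u v v≉0 = begin
      sumL (map (λ t → Σ< N (λ i → a i * pow (u + t * v) i)) (Fq q))
        ≈⟨ sumL-Σ<-comm N (λ t i → a i * pow (u + t * v) i) (Fq q) ⟩
      Σ< N (λ i → sumL (map (λ t → a i * pow (u + t * v) i) (Fq q)))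
        ≈⟨ Σ<-cong N (λ {i} _ → monomial-sum i) ⟩
      Σ< N (λ i → a i * pow v i * g i q (℘ w)) ∎
      where
      w = u * inv v v≉0
      u+tv≈v[t+w] : ∀ t → u + t * v ≈ v * (t + w)
      u+tv≈v[t+w] t = begin
        u + t * v                     ≈⟨ solve 3 (λ u t v → u :+ t :* v := t :* v :+ u :* con 1ℤ) refl u t v ⟩
        t * v + u * 1#                ≈⟨ +-congˡ (*-congˡ (*-inverseʳ v v≉0)) ⟨
        t * v + u * (v * inv v v≉0)   ≈⟨ solve 4 (λ u t v v⁻¹ → t :* v :+ u :* (v :* v⁻¹) := v :* (t :+ u :* v⁻¹))
                                                   refl u t v (inv v v≉0) ⟩
        v * (t + w)                   ∎
      monomial-sum : ∀ i → sumL (map (λ t → a i * pow (u + t * v) i) (Fq q)) ≈ a i * pow v i * g i q (℘ w)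
      monomial-sum i = begin
        sumL (map (λ t → a i * pow (u + t * v) i) (Fq q))
          ≈⟨ sumL-cong (Fq q) (λ {t} _ → trans (*-congˡ (trans (pow-cong i (u+tv≈v[t+w] t)) (pow-distrib-* v (t + w) i)))
                                                (sym (*-assoc _ _ _))) ⟩
        sumL (map (λ t → a i * pow v i * pow (t + w) i) (Fq q))
          ≈⟨ *-distribˡ-sumL _ (λ t → pow (t + w) i) (Fq q) ⟨
        a i * pow v i * shiftedPowerSum i w
          ≈⟨ *-congˡ (shiftedPowerSum≈g i w) ⟩
        a i * pow v i * g i q (℘ w) ∎

    -- w is a variable here: unifying against the witness computed by hilbert90 makes type checking blow up.
    sum-over-line-℘ : ∀ N a b d w (b≉0 : b ≉ 0#) → ℘ w ≈ d →
      sumL (map (λ t → polyFun N a (b * w + t * b)) (Fq q)) ≈ Σ< N (λ i → a i * pow b i * g i q d)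
    sum-over-line-℘ N a b d w b≉0 ℘w≈d = begin
      sumL (map (λ t → polyFun N a (b * w + t * b)) (Fq q))
        ≈⟨ sum-over-line N a (b * w) b b≉0 ⟩
      Σ< N (λ i → a i * pow b i * g i q (℘ (b * w * inv b b≉0)))
        ≈⟨ Σ<-cong N (λ {i} _ → *-congˡ (g-cong i q ℘[bw/b]≈d)) ⟩
      Σ< N (λ i → a i * pow b i * g i q d) ∎
      where
      bw/b≈w : b * w * inv b b≉0 ≈ w
      bw/b≈w = trans (*-congʳ (*-comm b w)) (trans (*-assoc w b _) (trans (*-congˡ (*-inverseʳ b b≉0)) (*-identityʳ w)))
      ℘[bw/b]≈d : ℘ (b * w * inv b b≉0) ≈ d
      ℘[bw/b]≈d = trans (+-cong (pow-cong q bw/b≈w) (-‿cong bw/b≈w)) ℘w≈d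

    SumFreeCriterion : (ℕ → Carrier) → Set (c ⊔ ℓ)
    SumFreeCriterion a = ∀ b d → b ≉ 0# → Tr q n d ≈ 0# → ¬ Σ< (q ^ n) (λ i → a i * pow b i * g i q d) ≈ 0#

    sumFree⇒criterion : ∀ a → SumFree1 q (polyFun (q ^ n) a) → SumFreeCriterion a
    sumFree⇒criterion a sum-free b d b≉0 Tr-d≈0 Σ≈0 =
      let w , ℘w≈d = hilbert90 d Tr-d≈0
      in sum-free (b * w) b b≉0 (trans (sum-over-line-℘ (q ^ n) a b d w b≉0 ℘w≈d) Σ≈0)

    criterion⇒sumFree : ∀ a → SumFreeCriterion a → SumFree1 q (polyFun (q ^ n) a)
    criterion⇒sumFree a criterion u v v≉0 line-sum≈0 =
      criterion v (℘ (u * inv v v≉0)) v≉0 (Tr-℘ _) (trans (sym (sum-over-line (q ^ n) a u v v≉0)) line-sum≈0)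

    sumFree⇔criterion : ∀ a → SumFree1 q (polyFun (q ^ n) a) ⇔ SumFreeCriterion a
    sumFree⇔criterion a = mk⇔ (sumFree⇒criterion a) (criterion⇒sumFree a)

proposition4p1 : ∀ {c ℓ} (F : FiniteField c ℓ) (p k q n : ℕ) →
    Prime p → k ≥ 1 → q ≡ p ^ k → n ≥ 1 →
    length (FiniteField.elements F) ≡ q ^ n →
    (a : ℕ → FiniteField.Carrier F) →
    let open FiniteField F
        open FF F
    in SumFree1 q (polyFun (q ^ n) a)
       ⇔ (∀ b d → ¬ (b ≈ 0#) → Tr q n d ≈ 0# →
            ¬ (Σ< (q ^ n) (λ i → a i * pow b i * g i q d) ≈ 0#))
proposition4p1 F p k q (suc n′) p-prime k≥1 q≡p^k (ℕ.s≤s ℕ.z≤n) |F|≡q^n a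
  with q₀ , ≡.refl ← ℕ.m≤n⇒∃[o]m+o≡n (≡.subst (2 ℕ.≤_) (≡.sym q≡p^k) (prime^k≥2 p-prime k≥1))
  = FiniteFieldTheory.PrimePowerOrder.sumFree⇔criterion F p k q₀ n′ p-prime q≡p^k |F|≡q^n a
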